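{- Let $G$ be a finite simple graph on $[d]$ without isolated vertices. Then the origin of $\mathbb{R}^d$ is the unique lattice point in the interior of $\mathcal{Q}(G)$, and the vertex set of the dual polytope $\mathcal{Q}(G)^\vee$ is $\{\mathbf{e}_i+\mathbf{e}_j : (i,j)\in E(G)\}\cup\{ -\mathbf{e}_i : 1\le i\le d\}$. In particular, if $G$ is bipartite, then $\mathcal{Q}(G)$ is a Gorenstein Fano polytope.
   Context: $E(G)$ is the edge set of $G$ and $\mathbf{e}_i$ the $i$th unit vector of $\mathbb{R}^d$. $\mathcal{Q}(G)=\{(x_1,\ldots,x_d)\in\mathbb{R}^d : x_i\ge -1\ (1\le i\le d),\ x_i+x_j\le 1\ ((i,j)\in E(G))\}$ (equivalently $3\,\mathrm{FRAC}(G)-(1,\ldots,1)$ where $\mathrm{FRAC}(G)=\{x\in\mathbb{R}^d: x_i\ge0,\ x_i+x_j\le1 \text{ for } (i,j)\in E(G)\}$). The dual polytope of a polytope $P\subset\mathbb{R}^d$ is $P^\vee=\{\mathbf{x}\in\mathbb{R}^d : \langle\mathbf{x},\mathbf{y}\rangle\le1 \text{ for all } \mathbf{y}\in P\}$. A $d$-dimensional lattice polytope $P\subset\mathbb{R}^d$ is Fano if the origin is the unique lattice point in its interior, and a Fano polytope is Gorenstein (reflexive) if $P^\vee$ is a lattice polytope.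
   Formalization: Stated over ℚ^d instead of ℝ^d: $\mathcal{Q}(G)$, its interior, the dual polytope $\mathcal{Q}(G)^\vee$, its vertices and the lattice polytopes in the Gorenstein Fano claim consist of rational points. -}

module Defs where

open import Data.Nat using (ℕ; zero; suc)
open import Data.Integer using (ℤ)
open import Data.Rational using (ℚ; 0ℚ; 1ℚ; _+_; _*_; -_; _-_; ∣_∣; _≤_; _<_; _/_)
open import Data.Fin using (Fin; zero; suc)
open import Data.Bool using (Bool; true; false)
open import Data.Product using (Σ; ∃; ∃-syntax; _×_)
open import Data.Sum using (_⊎_)
open import Relation.Binary.PropositionalEquality using (_≡_; _≢_)
open import Relation.Nullary using (¬_)
open import Function using (_∘_)

record SimpleGraph (d : ℕ) : Set where
  field
    adj    : Fin d → Fin d → Bool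
    sym    : ∀ i j → adj i j ≡ adj j i
    irrefl : ∀ i → adj i i ≡ false

open SimpleGraph public

Edge : ∀ {d} → SimpleGraph d → Fin d → Fin d → Set
Edge G i j = adj G i j ≡ true

NoIsolatedVertices : ∀ {d} → SimpleGraph d → Set
NoIsolatedVertices {d} G = ∀ (i : Fin d) → ∃[ j ] Edge G i j

Bipartite : ∀ {d} → SimpleGraph d → Set
Bipartite {d} G = Σ (Fin d → Bool) λ c → ∀ (i j : Fin d) → Edge G i j → c i ≢ c j

-- Points of ℚ^d (the rational points of ℝ^d) and subsets of ℚ^d
Pt : ℕ → Set
Pt d = Fin d → ℚ

Region : ℕ → Set₁
Region d = Pt d → Set

_≐_ : ∀ {d} → Pt d → Pt d → Set
x ≐ y = ∀ i → x i ≡ y i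

origin : ∀ {d} → Pt d
origin _ = 0ℚ

unit : ∀ {d} → Fin d → Pt d
unit zero    zero    = 1ℚ
unit zero    (suc _) = 0ℚ
unit (suc i) zero    = 0ℚ
unit (suc i) (suc k) = unit i k

_⊕_ : ∀ {d} → Pt d → Pt d → Pt d
(x ⊕ y) k = x k + y k

_⊛_ : ∀ {d} → ℚ → Pt d → Pt d
(t ⊛ x) k = t * x k

neg : ∀ {d} → Pt d → Pt d
neg x k = - x k

dot : ∀ {d} → Pt d → Pt d → ℚ
dot {zero}  x y = 0ℚ
dot {suc d} x y = x zero * y zero + dot (x ∘ suc) (y ∘ suc)

sumℚ : ∀ {n} → (Fin n → ℚ) → ℚ
sumℚ {zero}  f = 0ℚ
sumℚ {suc n} f = f zero + sumℚ (f ∘ suc)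

sumPt : ∀ {n d} → (Fin n → Pt d) → Pt d
sumPt f k = sumℚ (λ m → f m k)

IsLatticePoint : ∀ {d} → Pt d → Set
IsLatticePoint {d} x = ∀ (i : Fin d) → ∃[ z ] x i ≡ z / 1

QG : ∀ {d} → SimpleGraph d → Region d
QG {d} G x = (∀ (i : Fin d) → - 1ℚ ≤ x i)
           × (∀ (i j : Fin d) → Edge G i j → x i + x j ≤ 1ℚ)

Dual : ∀ {d} → Region d → Region d
Dual P x = ∀ y → P y → dot x y ≤ 1ℚ

-- interior (w.r.t. the standard topology; sup-norm balls)
Interior : ∀ {d} → Region d → Region d
Interior {d} P x = ∃[ ε ] (0ℚ < ε × (∀ y → (∀ (i : Fin d) → ∣ y i - x i ∣ < ε) → P y))

IsVertex : ∀ {d} → Region d → Pt d → Set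
IsVertex P x = P x × (∀ y z t → P y → P z → 0ℚ < t → t < 1ℚ →
                        x ≐ ((t ⊛ y) ⊕ ((1ℚ - t) ⊛ z)) → y ≐ x)

InConvexHull : ∀ {n d} → (Fin n → Pt d) → Pt d → Set
InConvexHull {n} v x = ∃[ λs ] ((∀ (m : Fin n) → 0ℚ ≤ λs m) × sumℚ λs ≡ 1ℚ
                                × x ≐ sumPt (λ m → λs m ⊛ v m))

IsLatticePolytope : ∀ {d} → Region d → Set
IsLatticePolytope {d} P = ∃[ n ] Σ (Fin n → Pt d) λ v →
  (∀ m → IsLatticePoint (v m)) × (∀ x → (P x → InConvexHull v x) × (InConvexHull v x → P x))

OriginUniqueInteriorLatticePoint : ∀ {d} → Region d → Set
OriginUniqueInteriorLatticePoint P =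
  Interior P origin × (∀ x → IsLatticePoint x → Interior P x → x ≐ origin)

-- Fano: a d-dimensional (i.e. full-dimensional: nonempty interior) lattice polytope
-- whose interior contains the origin as unique lattice point
IsFano : ∀ {d} → Region d → Set
IsFano P = IsLatticePolytope P × (∃[ x ] Interior P x) × OriginUniqueInteriorLatticePoint P

-- Gorenstein (reflexive) Fano polytope: Fano with lattice dual
IsGorensteinFano : ∀ {d} → Region d → Set
IsGorensteinFano P = IsFano P × IsLatticePolytope (Dual P)

DualVertexSet : ∀ {d} → SimpleGraph d → Region d
DualVertexSet G x = (∃[ i ] ∃[ j ] (Edge G i j × x ≐ (unit i ⊕ unit j)))
                  ⊎ (∃[ i ] x ≐ neg (unit i))

-- Near the origin Q(G) contains the cube of radius ½. If a lattice point x is interior, the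
-- points x ± δ e_i lie in Q(G): x_i − δ ≥ −1 forces x_i ≥ 0 for all i, and then
-- x_i + δ + x_j ≤ 1 along an edge {i, j} forces x_i ≤ 0.
--
-- Q(G)^∨ is the convex hull of 0, the −e_i and the e_i + e_j for edges {i, j}: if c and β
-- satisfy ⟨c, g⟩ ≤ β on these generators, a positive multiple of c lies in Q(G), so every x in
-- the dual satisfies ⟨c, x⟩ ≤ β, and Farkas' lemma (proved by Fourier–Motzkin elimination)
-- turns this into membership in the hull. A vertex of a hull is one of its generators; 0 is
-- not a vertex, being ⅓ (e_i + e_j) + ⅔ (−½ (e_i + e_j)), while each remaining generator x is
-- recovered coordinatewise from test points q ∈ Q(G) with ⟨x, q⟩ = 1, which stay tight on
-- both parts of any splitting of x.
--
-- For bipartite G, a rational point x of Q(G) with N x integral is the average of N lattice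
-- points of Q(G), obtained by threshold rounding on the two colour classes (Hermite's
-- identity Σ_{k<N} ⌊(a + k)/N⌋ = a). These lie in {−1, 0, 1, 2}^d, and by Farkas' lemma again
-- Q(G) is the convex hull of the finitely many lattice points it contains.

module Submission where

open import Defs hiding (sym)
open import Data.Bool as Bool using (Bool; true; false)
open import Data.Fin using (Fin; zero; suc; toℕ; fromℕ<)
open import Data.Fin.Properties using (_≟_; toℕ<n; all?)
open import Data.Integer as ℤ using (ℤ; +_; -[1+_]; 0ℤ; 1ℤ; -1ℤ)
import Data.Integer.DivMod as ℤ
import Data.Integer.Properties as ℤ
open import Data.List using (List; []; _∷_; _++_; map; filter; concat; tabulate; cartesianProduct; cartesianProductWith; allFin; lookup; length)
import Data.List.Extrema
open import Data.List.Membership.Propositional using (_∈_; find)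
open import Data.List.Membership.Propositional.Properties using (∈-map⁺; ∈-map⁻; ∈-filter⁺; ∈-filter⁻; ∈-++⁻; ∈-++⁺ˡ; ∈-++⁺ʳ; ∈-tabulate⁺; ∈-tabulate⁻; ∈-cartesianProduct⁺; ∈-cartesianProductWith⁺; ∈-cartesianProductWith⁻; ∈-allFin; ∈-lookup)
open import Data.List.Relation.Unary.All as All using (All; []; _∷_)
import Data.List.Relation.Unary.All.Properties as All
open import Data.List.Relation.Unary.Any as Any using (here; there)
open import Data.List.Relation.Unary.Any.Properties using (lookup-index)
open import Data.Nat as ℕ using (ℕ; zero; suc)
import Data.Nat.Coprimality as Coprimality
import Data.Nat.DivMod as ℕ
import Data.Nat.Properties as ℕ
open import Data.Product using (Σ; ∃-syntax; _×_; _,_; proj₁; proj₂)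
open import Data.Rational using (ℚ; mkℚ; toℚᵘ; 0ℚ; 1ℚ; _+_; _*_; -_; _-_; ∣_∣; _≤_; _<_; _/_; 1/_; *≤*; *<*; ↥_; ↧ₙ_; positive; nonNegative; >-nonZero)
open import Data.Rational.Properties as ℚ using (≤-refl; ≤-trans; <-≤-trans; ≤-<-trans; <⇒≤; ≤-antisym; <-cmp; _≤?_)
open import Data.Rational.Solver using (module +-*-Solver)
open import Data.Rational.Unnormalised as ℚᵘ using (mkℚᵘ; *≡*)
import Data.Rational.Unnormalised.Properties as ℚᵘ
open import Data.Sum using (_⊎_; inj₁; inj₂)
open import Function using (_∘_)
open import Function.Bundles using (_⇔_; mk⇔)
open import Relation.Binary using (tri<; tri≈; tri>; DecidableEquality)
open import Relation.Binary.Bundles using (DecTotalOrder)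
open import Relation.Binary.PropositionalEquality using (_≡_; _≢_; refl; sym; trans; cong; cong₂; subst; subst₂; module ≡-Reasoning)
open import Relation.Nullary using (¬_; Dec; yes; no; contradiction)
open import Relation.Nullary.Decidable using (from-yes; _×-dec_; _→-dec_)

open +-*-Solver using (solve; _:=_; _:+_; _:*_; :-_; _:-_; con)

module Extrema = Data.List.Extrema (DecTotalOrder.totalOrder ℚ.≤-decTotalOrder)

p≤q⇒0≤q-p : ∀ {p q} → p ≤ q → 0ℚ ≤ q - p
p≤q⇒0≤q-p {p} {q} p≤q = subst (_≤ q - p) (ℚ.+-inverseʳ p) (ℚ.+-monoˡ-≤ (- p) p≤q)

p<q⇒0<q-p : ∀ {p q} → p < q → 0ℚ < q - p
p<q⇒0<q-p {p} {q} p<q = subst (_< q - p) (ℚ.+-inverseʳ p) (ℚ.+-monoˡ-< (- p) p<q)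

e+p≡q : ∀ {e p q} → e ≡ q - p → e + p ≡ q
e+p≡q {e} {p} {q} refl = solve 2 (λ p q → (q :- p) :+ p := q) refl p q

≤-fromDifference : ∀ {e p q} → 0ℚ ≤ e → e ≡ q - p → p ≤ q
≤-fromDifference {e} {p} 0≤e e≡q-p =
  subst₂ _≤_ (ℚ.+-identityˡ p) (e+p≡q e≡q-p) (ℚ.+-monoˡ-≤ p 0≤e)

<-fromDifference : ∀ {e p q} → 0ℚ < e → e ≡ q - p → p < q
<-fromDifference {e} {p} 0<e e≡q-p =
  subst₂ _<_ (ℚ.+-identityˡ p) (e+p≡q e≡q-p) (ℚ.+-monoˡ-< p 0<e)

0<1 : 0ℚ < 1ℚ
0<1 = ℚ.positive⁻¹ 1ℚ

*-monoˡ-≤-0≤ : ∀ {r p q} → 0ℚ ≤ r → p ≤ q → r * p ≤ r * q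
*-monoˡ-≤-0≤ {r} 0≤r = ℚ.*-monoˡ-≤-nonNeg r {{nonNegative 0≤r}}

*-monoˡ-<-0< : ∀ {r p q} → 0ℚ < r → p < q → r * p < r * q
*-monoˡ-<-0< {r} 0<r = ℚ.*-monoʳ-<-pos r {{positive 0<r}}

*-cancelˡ-≤-0< : ∀ {r p q} → 0ℚ < r → r * p ≤ r * q → p ≤ q
*-cancelˡ-≤-0< {r} 0<r = ℚ.*-cancelˡ-≤-pos r {{positive 0<r}}

0≤* : ∀ {p q} → 0ℚ ≤ p → 0ℚ ≤ q → 0ℚ ≤ p * q
0≤* {p} 0≤p 0≤q = subst (_≤ p * _) (ℚ.*-zeroʳ p) (*-monoˡ-≤-0≤ 0≤p 0≤q)

0<* : ∀ {p q} → 0ℚ < p → 0ℚ < q → 0ℚ < p * q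
0<* {p} 0<p 0<q = subst (_< p * _) (ℚ.*-zeroʳ p) (*-monoˡ-<-0< 0<p 0<q)

½ : ℚ
½ = ℤ.+ 1 / 2

0<½ : 0ℚ < ½
0<½ = ℚ.positive⁻¹ ½

½<1 : ½ < 1ℚ
½<1 = from-yes (½ ℚ.<? 1ℚ)

reciprocal : ∀ {r} → 0ℚ < r → ∃[ s ] 0ℚ < s × r * s ≡ 1ℚ
reciprocal {r} 0<r =
    1/_ r {{>-nonZero 0<r}}
  , ℚ.positive⁻¹ _ {{ℚ.1/pos⇒pos r {{positive 0<r}}}}
  , ℚ.*-inverseʳ r {{>-nonZero 0<r}}

neg-involutive : ∀ p → - (- p) ≡ p
neg-involutive p = solve 1 (λ p → :- (:- p) := p) refl p

p≤∣p∣ : ∀ p → p ≤ ∣ p ∣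
p≤∣p∣ (mkℚ (+ n)    _ _) = ≤-refl
p≤∣p∣ (mkℚ -[1+ n ] _ _) = *≤* ℤ.-≤+

∣p∣<e⇒-e<p<e : ∀ {p e} → ∣ p ∣ < e → - e < p × p < e
∣p∣<e⇒-e<p<e {p} {e} ∣p∣<e =
    subst (- e <_) (neg-involutive p) (ℚ.neg-antimono-< (≤-<-trans (subst (- p ≤_) (ℚ.∣-p∣≡∣p∣ p) (p≤∣p∣ (- p))) ∣p∣<e))
  , ≤-<-trans (p≤∣p∣ p) ∣p∣<e

-1≤⇒-≤1 : ∀ {p} → - 1ℚ ≤ p → - p ≤ 1ℚ
-1≤⇒-≤1 {p} -1≤p = subst (- p ≤_) (neg-involutive 1ℚ) (ℚ.neg-antimono-≤ -1≤p)

separating-scale : ∀ {β α} → 0ℚ ≤ β → β < α → ∃[ s ] 0ℚ < s × s * β ≤ 1ℚ × 1ℚ < s * α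
separating-scale {β} {α} 0≤β β<α = r + r , ℚ.+-mono-< 0<r 0<r , s*β≤1 , 1<s*α
  where
  0<β+α : 0ℚ < β + α
  0<β+α = ℚ.+-mono-≤-< 0≤β (≤-<-trans 0≤β β<α)
  r-reciprocal = reciprocal 0<β+α
  r = proj₁ r-reciprocal
  0<r = proj₁ (proj₂ r-reciprocal)
  rβ+rα≡1 : r * β + r * α ≡ 1ℚ
  rβ+rα≡1 = trans (sym (ℚ.*-distribˡ-+ r β α)) (trans (ℚ.*-comm r (β + α)) (proj₂ (proj₂ r-reciprocal)))
  s*β≤1 : (r + r) * β ≤ 1ℚ
  s*β≤1 = ≤-trans (ℚ.≤-reflexive (ℚ.*-distribʳ-+ β r r))
            (≤-trans (ℚ.+-monoʳ-≤ (r * β) (*-monoˡ-≤-0≤ (<⇒≤ 0<r) (<⇒≤ β<α))) (ℚ.≤-reflexive rβ+rα≡1))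
  1<s*α : 1ℚ < (r + r) * α
  1<s*α = <-≤-trans (subst (_< r * α + r * α) rβ+rα≡1 (ℚ.+-monoˡ-< (r * α) (*-monoˡ-<-0< 0<r β<α)))
            (ℚ.≤-reflexive (sym (ℚ.*-distribʳ-+ α r r)))

sumℚ-cong : ∀ {n} {f g : Fin n → ℚ} → (∀ k → f k ≡ g k) → sumℚ f ≡ sumℚ g
sumℚ-cong {zero}  f≗g = refl
sumℚ-cong {suc n} f≗g = cong₂ _+_ (f≗g zero) (sumℚ-cong (f≗g ∘ suc))

sumℚ-zero : ∀ {n} {f : Fin n → ℚ} → (∀ k → f k ≡ 0ℚ) → sumℚ f ≡ 0ℚ
sumℚ-zero {zero}  f≗0 = refl
sumℚ-zero {suc n} f≗0 = trans (cong₂ _+_ (f≗0 zero) (sumℚ-zero (f≗0 ∘ suc))) (ℚ.+-identityˡ 0ℚ)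

sumℚ-+ : ∀ {n} (f g : Fin n → ℚ) → sumℚ (λ k → f k + g k) ≡ sumℚ f + sumℚ g
sumℚ-+ {zero}  f g = sym (ℚ.+-identityˡ 0ℚ)
sumℚ-+ {suc n} f g = trans (cong (λ s → f zero + g zero + s) (sumℚ-+ (f ∘ suc) (g ∘ suc)))
  (solve 4 (λ a b p q → (a :+ b) :+ (p :+ q) := (a :+ p) :+ (b :+ q)) refl
    (f zero) (g zero) (sumℚ (f ∘ suc)) (sumℚ (g ∘ suc)))

sumℚ-*ˡ : ∀ {n} t (f : Fin n → ℚ) → sumℚ (λ k → t * f k) ≡ t * sumℚ f
sumℚ-*ˡ {zero}  t f = sym (ℚ.*-zeroʳ t)
sumℚ-*ˡ {suc n} t f = trans (cong (λ s → t * f zero + s) (sumℚ-*ˡ t (f ∘ suc)))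
  (sym (ℚ.*-distribˡ-+ t (f zero) (sumℚ (f ∘ suc))))

sumℚ-neg : ∀ {n} (f : Fin n → ℚ) → sumℚ (λ k → - f k) ≡ - sumℚ f
sumℚ-neg {zero}  f = refl
sumℚ-neg {suc n} f = trans (cong (λ s → - f zero + s) (sumℚ-neg (f ∘ suc)))
  (sym (ℚ.neg-distrib-+ (f zero) (sumℚ (f ∘ suc))))

sumℚ-linear : ∀ {n} (f g : Fin n → ℚ) t → sumℚ (λ k → f k - t * g k) ≡ sumℚ f - t * sumℚ g
sumℚ-linear f g t = begin
  sumℚ (λ k → f k - t * g k)          ≡⟨ sumℚ-+ f (λ k → - (t * g k)) ⟩
  sumℚ f + sumℚ (λ k → - (t * g k))   ≡⟨ cong (λ s → sumℚ f + s) (sumℚ-neg (λ k → t * g k)) ⟩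
  sumℚ f - sumℚ (λ k → t * g k)       ≡⟨ cong (λ s → sumℚ f - s) (sumℚ-*ˡ t g) ⟩
  sumℚ f - t * sumℚ g                 ∎
  where open ≡-Reasoning

sumℚ-mono-≤ : ∀ {n} {f g : Fin n → ℚ} → (∀ k → f k ≤ g k) → sumℚ f ≤ sumℚ g
sumℚ-mono-≤ {zero}  f≤g = ≤-refl
sumℚ-mono-≤ {suc n} f≤g = ℚ.+-mono-≤ (f≤g zero) (sumℚ-mono-≤ (f≤g ∘ suc))

sumℚ-nonNeg : ∀ {n} {f : Fin n → ℚ} → (∀ k → 0ℚ ≤ f k) → 0ℚ ≤ sumℚ f
sumℚ-nonNeg {n} {f} 0≤f = subst (_≤ sumℚ f) (sumℚ-zero {n} (λ _ → refl)) (sumℚ-mono-≤ 0≤f)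

term≤sumℚ : ∀ {n} {f : Fin n → ℚ} → (∀ k → 0ℚ ≤ f k) → ∀ m → f m ≤ sumℚ f
term≤sumℚ {suc n} {f} 0≤f zero =
  subst (_≤ sumℚ f) (ℚ.+-identityʳ (f zero)) (ℚ.+-monoʳ-≤ (f zero) (sumℚ-nonNeg (0≤f ∘ suc)))
term≤sumℚ {suc n} {f} 0≤f (suc m) =
  subst (_≤ sumℚ f) (ℚ.+-identityˡ (f (suc m))) (ℚ.+-mono-≤ (0≤f zero) (term≤sumℚ (0≤f ∘ suc) m))

0<sumℚ⇒∃0< : ∀ {n} (f : Fin n → ℚ) → 0ℚ < sumℚ f → ∃[ m ] 0ℚ < f m
0<sumℚ⇒∃0< {zero}  f 0<0 = contradiction 0<0 (ℚ.<-irrefl refl)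
0<sumℚ⇒∃0< {suc n} f 0<Σ with 0ℚ ℚ.<? f zero
... | yes 0<f₀ = zero , 0<f₀
... | no  0≮f₀ = let m , 0<fₘ = 0<sumℚ⇒∃0< (f ∘ suc) 0<Σ′ in suc m , 0<fₘ
  where
  Σ′ = sumℚ (f ∘ suc)
  0<Σ′ : 0ℚ < Σ′
  0<Σ′ = <-≤-trans 0<Σ (subst (f zero + Σ′ ≤_) (ℚ.+-identityˡ Σ′) (ℚ.+-monoˡ-≤ Σ′ (ℚ.≮⇒≥ 0≮f₀)))

sumℚ-telescope : ∀ n (g : ℕ → ℚ) →
  sumℚ {n} (λ k → g (suc (toℕ k))) + g 0 ≡ sumℚ {n} (λ k → g (toℕ k)) + g n
sumℚ-telescope zero    g = refl
sumℚ-telescope (suc n) g = begin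
  (g 1 + S₁) + g 0         ≡⟨ solve 3 (λ a b c → (a :+ b) :+ c := c :+ (b :+ a)) refl (g 1) S₁ (g 0) ⟩
  g 0 + (S₁ + g 1)         ≡⟨ cong (λ s → g 0 + s) (sumℚ-telescope n (g ∘ suc)) ⟩
  g 0 + (S₀ + g (suc n))   ≡⟨ sym (ℚ.+-assoc (g 0) S₀ (g (suc n))) ⟩
  (g 0 + S₀) + g (suc n)   ∎
  where
  open ≡-Reasoning
  S₁ = sumℚ {n} (λ k → g (suc (suc (toℕ k))))
  S₀ = sumℚ {n} (λ k → g (suc (toℕ k)))

unit-same : ∀ {d} (i : Fin d) → unit i i ≡ 1ℚ
unit-same zero    = refl
unit-same (suc i) = unit-same i

unit-diff : ∀ {d} {i j : Fin d} → i ≢ j → unit i j ≡ 0ℚ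
unit-diff {i = zero}  {zero}  i≢j = contradiction refl i≢j
unit-diff {i = zero}  {suc j} i≢j = refl
unit-diff {i = suc i} {zero}  i≢j = refl
unit-diff {i = suc i} {suc j} i≢j = unit-diff (i≢j ∘ cong suc)

0≤unit : ∀ {d} (i j : Fin d) → 0ℚ ≤ unit i j
0≤unit i j with i ≟ j
... | yes refl = subst (0ℚ ≤_) (sym (unit-same i)) (<⇒≤ 0<1)
... | no  i≢j  = ℚ.≤-reflexive (sym (unit-diff i≢j))

unit≤1 : ∀ {d} (i j : Fin d) → unit i j ≤ 1ℚ
unit≤1 i j with i ≟ j
... | yes refl = ℚ.≤-reflexive (unit-same i)
... | no  i≢j  = subst (_≤ 1ℚ) (sym (unit-diff i≢j)) (<⇒≤ 0<1)

sumℚ-unit : ∀ {n} (m : Fin n) (f : Fin n → ℚ) → sumℚ (λ k → unit m k * f k) ≡ f m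
sumℚ-unit zero f = begin
  1ℚ * f zero + sumℚ (λ k → 0ℚ * f (suc k)) ≡⟨ cong₂ _+_ (ℚ.*-identityˡ (f zero)) (sumℚ-zero (λ k → ℚ.*-zeroˡ (f (suc k)))) ⟩
  f zero + 0ℚ                              ≡⟨ ℚ.+-identityʳ (f zero) ⟩
  f zero                                   ∎
  where open ≡-Reasoning
sumℚ-unit (suc m) f =
  trans (cong₂ _+_ (ℚ.*-zeroˡ (f zero)) (sumℚ-unit m (f ∘ suc))) (ℚ.+-identityˡ (f (suc m)))

sumℚ-unit≡1 : ∀ {n} (m : Fin n) → sumℚ (unit m) ≡ 1ℚ
sumℚ-unit≡1 m = trans (sumℚ-cong (λ k → sym (ℚ.*-identityʳ (unit m k)))) (sumℚ-unit m (λ _ → 1ℚ))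

sumℚ-peel : ∀ {n} (l w : Fin n → ℚ) m {t r} → (1ℚ - t) * r ≡ 1ℚ →
  t * w m + (1ℚ - t) * sumℚ (λ k → (r * (l k - t * unit m k)) * w k) ≡ sumℚ (λ k → l k * w k)
sumℚ-peel l w m {t} {r} [1-t]r≡1 = begin
  t * w m + (1ℚ - t) * sumℚ (λ k → (r * (l k - t * unit m k)) * w k)
    ≡⟨ cong (λ s → t * w m + (1ℚ - t) * s) rest ⟩
  t * w m + (1ℚ - t) * (r * (S - t * w m))
    ≡⟨ solve 5 (λ t a c r X → t :* a :+ c :* (r :* X) := t :* a :+ (c :* r) :* X) refl t (w m) (1ℚ - t) r (S - t * w m) ⟩
  t * w m + ((1ℚ - t) * r) * (S - t * w m)
    ≡⟨ cong (λ s → t * w m + s * (S - t * w m)) [1-t]r≡1 ⟩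
  t * w m + 1ℚ * (S - t * w m)
    ≡⟨ solve 3 (λ t a S → t :* a :+ con 1ℚ :* (S :- t :* a) := S) refl t (w m) S ⟩
  S ∎
  where
  open ≡-Reasoning
  S = sumℚ (λ k → l k * w k)
  rest : sumℚ (λ k → (r * (l k - t * unit m k)) * w k) ≡ r * (S - t * w m)
  rest = begin
    sumℚ (λ k → (r * (l k - t * unit m k)) * w k)
      ≡⟨ sumℚ-cong (λ k → solve 5 (λ r a t e b → (r :* (a :- t :* e)) :* b := r :* (a :* b :- t :* (e :* b))) refl
                                    r (l k) t (unit m k) (w k)) ⟩
    sumℚ (λ k → r * (l k * w k - t * (unit m k * w k)))
      ≡⟨ sumℚ-*ˡ r (λ k → l k * w k - t * (unit m k * w k)) ⟩
    r * sumℚ (λ k → l k * w k - t * (unit m k * w k))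
      ≡⟨ cong (r *_) (sumℚ-linear (λ k → l k * w k) (λ k → unit m k * w k) t) ⟩
    r * (S - t * sumℚ (λ k → unit m k * w k))
      ≡⟨ cong (λ X → r * (S - t * X)) (sumℚ-unit m w) ⟩
    r * (S - t * w m) ∎

dot≡sumℚ : ∀ {d} (x y : Pt d) → dot x y ≡ sumℚ (λ k → x k * y k)
dot≡sumℚ {zero}  x y = refl
dot≡sumℚ {suc d} x y = cong (λ s → x zero * y zero + s) (dot≡sumℚ (x ∘ suc) (y ∘ suc))

dot-comm : ∀ {d} (x y : Pt d) → dot x y ≡ dot y x
dot-comm x y = trans (dot≡sumℚ x y) (trans (sumℚ-cong (λ k → ℚ.*-comm (x k) (y k))) (sym (dot≡sumℚ y x)))

dot-congʳ : ∀ {d} (x : Pt d) {y y′ : Pt d} → y ≐ y′ → dot x y ≡ dot x y′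
dot-congʳ x {y} {y′} y≐y′ =
  trans (dot≡sumℚ x y) (trans (sumℚ-cong (λ k → cong (x k *_) (y≐y′ k))) (sym (dot≡sumℚ x y′)))

dot-congˡ : ∀ {d} {x x′ : Pt d} (y : Pt d) → x ≐ x′ → dot x y ≡ dot x′ y
dot-congˡ {x = x} {x′} y x≐x′ = trans (dot-comm x y) (trans (dot-congʳ y x≐x′) (dot-comm y x′))

dot-⊕ʳ : ∀ {d} (x y z : Pt d) → dot x (y ⊕ z) ≡ dot x y + dot x z
dot-⊕ʳ x y z = begin
  dot x (y ⊕ z)                          ≡⟨ dot≡sumℚ x (y ⊕ z) ⟩
  sumℚ (λ k → x k * (y k + z k))         ≡⟨ sumℚ-cong (λ k → ℚ.*-distribˡ-+ (x k) (y k) (z k)) ⟩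
  sumℚ (λ k → x k * y k + x k * z k)     ≡⟨ sumℚ-+ (λ k → x k * y k) (λ k → x k * z k) ⟩
  sumℚ (λ k → x k * y k) + sumℚ (λ k → x k * z k) ≡⟨ sym (cong₂ _+_ (dot≡sumℚ x y) (dot≡sumℚ x z)) ⟩
  dot x y + dot x z                      ∎
  where open ≡-Reasoning

dot-⊛ʳ : ∀ {d} (x : Pt d) t (y : Pt d) → dot x (t ⊛ y) ≡ t * dot x y
dot-⊛ʳ x t y = begin
  dot x (t ⊛ y)                ≡⟨ dot≡sumℚ x (t ⊛ y) ⟩
  sumℚ (λ k → x k * (t * y k)) ≡⟨ sumℚ-cong (λ k → solve 3 (λ a t b → a :* (t :* b) := t :* (a :* b)) refl (x k) t (y k)) ⟩
  sumℚ (λ k → t * (x k * y k)) ≡⟨ sumℚ-*ˡ t (λ k → x k * y k) ⟩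
  t * sumℚ (λ k → x k * y k)   ≡⟨ cong (t *_) (sym (dot≡sumℚ x y)) ⟩
  t * dot x y                  ∎
  where open ≡-Reasoning

dot-negʳ : ∀ {d} (x y : Pt d) → dot x (neg y) ≡ - dot x y
dot-negʳ x y = begin
  dot x (neg y)                  ≡⟨ dot≡sumℚ x (neg y) ⟩
  sumℚ (λ k → x k * - y k)       ≡⟨ sumℚ-cong (λ k → sym (ℚ.neg-distribʳ-* (x k) (y k))) ⟩
  sumℚ (λ k → - (x k * y k))     ≡⟨ sumℚ-neg (λ k → x k * y k) ⟩
  - sumℚ (λ k → x k * y k)       ≡⟨ cong -_ (sym (dot≡sumℚ x y)) ⟩
  - dot x y                      ∎
  where open ≡-Reasoning

dot-originʳ : ∀ {d} (x : Pt d) → dot x origin ≡ 0ℚ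
dot-originʳ x = trans (dot≡sumℚ x origin) (sumℚ-zero (λ k → ℚ.*-zeroʳ (x k)))

dot-unitʳ : ∀ {d} (x : Pt d) (i : Fin d) → dot x (unit i) ≡ x i
dot-unitʳ x i = trans (dot≡sumℚ x (unit i)) (trans (sumℚ-cong (λ k → ℚ.*-comm (x k) (unit i k))) (sumℚ-unit i x))

dot-unitˡ : ∀ {d} (i : Fin d) (x : Pt d) → dot (unit i) x ≡ x i
dot-unitˡ i x = trans (dot-comm (unit i) x) (dot-unitʳ x i)

dot-sumPt : ∀ {n d} (u : Pt d) (R : Fin n → Pt d) → dot u (sumPt R) ≡ sumℚ (λ m → dot u (R m))
dot-sumPt {zero}  u R = dot-originʳ u
dot-sumPt {suc n} u R = trans (dot-⊕ʳ u (R zero) (sumPt (R ∘ suc))) (cong (λ s → dot u (R zero) + s) (dot-sumPt u (R ∘ suc)))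

dot-combination : ∀ {n d} (u : Pt d) (l : Fin n → ℚ) (v : Fin n → Pt d) →
  dot u (sumPt (λ m → l m ⊛ v m)) ≡ sumℚ (λ m → l m * dot u (v m))
dot-combination u l v = trans (dot-sumPt u (λ m → l m ⊛ v m)) (sumℚ-cong (λ m → dot-⊛ʳ u (l m) (v m)))

dot-originˡ : ∀ {d} (x : Pt d) → dot origin x ≡ 0ℚ
dot-originˡ x = trans (dot-comm origin x) (dot-originʳ x)

dot-⊛ˡ : ∀ {d} t (x y : Pt d) → dot (t ⊛ x) y ≡ t * dot x y
dot-⊛ˡ t x y = trans (dot-comm (t ⊛ x) y) (trans (dot-⊛ʳ y t x) (cong (t *_) (dot-comm y x)))

dot-⊕ˡ : ∀ {d} (x y z : Pt d) → dot (x ⊕ y) z ≡ dot x z + dot y z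
dot-⊕ˡ x y z = trans (dot-comm (x ⊕ y) z) (trans (dot-⊕ʳ z x y) (cong₂ _+_ (dot-comm z x) (dot-comm z y)))

dot-negˡ : ∀ {d} (x y : Pt d) → dot (neg x) y ≡ - dot x y
dot-negˡ x y = trans (dot-comm (neg x) y) (trans (dot-negʳ y x) (cong -_ (dot-comm y x)))

dot-neg-unitˡ : ∀ {d} (i : Fin d) (x : Pt d) → dot (neg (unit i)) x ≡ - x i
dot-neg-unitˡ i x = trans (dot-negˡ (unit i) x) (cong -_ (dot-unitˡ i x))

dot-unit-pairˡ : ∀ {d} (i j : Fin d) (x : Pt d) → dot (unit i ⊕ unit j) x ≡ x i + x j
dot-unit-pairˡ i j x = trans (dot-⊕ˡ (unit i) (unit j) x) (cong₂ _+_ (dot-unitˡ i x) (dot-unitˡ j x))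

dot-neg-unitʳ : ∀ {d} (x : Pt d) (i : Fin d) → dot x (neg (unit i)) ≡ - x i
dot-neg-unitʳ x i = trans (dot-negʳ x (unit i)) (cong -_ (dot-unitʳ x i))

dot-unit-differenceʳ : ∀ {d} (x : Pt d) (i k : Fin d) → dot x (unit i ⊕ neg (unit k)) ≡ x i - x k
dot-unit-differenceʳ x i k = trans (dot-⊕ʳ x (unit i) (neg (unit k))) (cong₂ _+_ (dot-unitʳ x i) (dot-neg-unitʳ x k))

-- Fourier–Motzkin elimination

Constraint : ℕ → Set
Constraint d = Pt d × ℚ

Satisfies : ∀ {d} → Pt d → Constraint d → Set
Satisfies y (g , b) = dot g y ≤ b

infix 4 _⊢_

data _⊢_ {d} (S : List (Constraint d)) : Constraint d → Set where
  assumption : ∀ {c} → c ∈ S → S ⊢ c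
  add        : ∀ {g h b c} → S ⊢ (g , b) → S ⊢ (h , c) → S ⊢ (g ⊕ h , b + c)
  scale      : ∀ {g b} q → 0ℚ ≤ q → S ⊢ (g , b) → S ⊢ (q ⊛ g , q * b)
  cast       : ∀ {g g′ b} → S ⊢ (g , b) → g ≐ g′ → S ⊢ (g′ , b)

Feasible : ∀ {d} → List (Constraint d) → Set
Feasible S = ∃[ y ] All (Satisfies y) S

Refutable : ∀ {d} → List (Constraint d) → Set
Refutable S = ∃[ b ] b < 0ℚ × S ⊢ (origin , b)

cons : ∀ {d} → ℚ → Pt d → Pt (suc d)
cons a x zero    = a
cons a x (suc i) = x i

-- Scaled so that the first variable y₀ has coefficient 1, −1 or 0, a constraint bounds y₀ from
-- above, from below, or not at all.
data Sign : Set where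
  upper lower free : Sign

_≟ˢ_ : DecidableEquality Sign
upper ≟ˢ upper = yes refl
upper ≟ˢ lower = no λ ()
upper ≟ˢ free  = no λ ()
lower ≟ˢ upper = no λ ()
lower ≟ˢ lower = yes refl
lower ≟ˢ free  = no λ ()
free  ≟ˢ upper = no λ ()
free  ≟ˢ lower = no λ ()
free  ≟ˢ free  = yes refl

coefficient : Sign → ℚ
coefficient upper = 1ℚ
coefficient lower = - 1ℚ
coefficient free  = 0ℚ

embed : ∀ {d} → Sign → Constraint d → Constraint (suc d)
embed s (g , b) = cons (coefficient s) g , b

normalising-factor : (a : ℚ) → Σ Sign λ s → ∃[ r ] 0ℚ < r × r * a ≡ coefficient s
normalising-factor a with <-cmp a 0ℚ
... | tri< a<0 _ _ with reciprocal (ℚ.neg-antimono-< a<0)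
...   | r , 0<r , -a*r≡1 = lower , r , 0<r ,
          trans (solve 2 (λ r a → r :* a := :- ((:- a) :* r)) refl r a) (cong -_ -a*r≡1)
normalising-factor a | tri≈ _ a≡0 _ = free , 1ℚ , 0<1 , trans (ℚ.*-identityˡ a) a≡0
normalising-factor a | tri> _ _ 0<a with reciprocal 0<a
...   | r , 0<r , a*r≡1 = upper , r , 0<r , trans (ℚ.*-comm r a) a*r≡1

record Normalised {d} (c : Constraint (suc d)) : Set where
  field
    sign     : Sign
    factor   : ℚ
    0<factor : 0ℚ < factor
    scaled   : factor * proj₁ c zero ≡ coefficient sign

  rest : Constraint d
  rest = factor ⊛ (proj₁ c ∘ suc) , factor * proj₂ c

  embed-rest : proj₁ (embed sign rest) ≐ (factor ⊛ proj₁ c)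
  embed-rest zero    = sym scaled
  embed-rest (suc i) = refl

normalise : ∀ {d} (c : Constraint (suc d)) → Normalised c
normalise (g , b) with normalising-factor (g zero)
... | s , r , 0<r , r*g₀≡s = record { sign = s ; factor = r ; 0<factor = 0<r ; scaled = r*g₀≡s }

module _ {d : ℕ} where
  open Normalised

  normalised-⊢ : ∀ {S : List (Constraint (suc d))} {c} → c ∈ S → S ⊢ embed (sign (normalise c)) (rest (normalise c))
  normalised-⊢ {c = c} c∈S =
    cast (scale (factor N) (<⇒≤ (0<factor N)) (assumption c∈S)) (λ i → sym (embed-rest N i))
    where N = normalise c

  normalised-sound : ∀ y c → Satisfies {suc d} y (embed (sign (normalise c)) (rest (normalise c))) → Satisfies y c
  normalised-sound y c@(g , b) sat = *-cancelˡ-≤-0< (0<factor N)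
    (subst (_≤ factor N * b) (trans (dot-congˡ y (embed-rest N)) (dot-⊛ˡ (factor N) g y)) sat)
    where N = normalise c

  bounds : Sign → List (Constraint (suc d)) → List (Constraint d)
  bounds s S = map (rest ∘ normalise) (filter (λ c → sign (normalise c) ≟ˢ s) S)

  ∈-bounds⁺ : ∀ {S : List (Constraint (suc d))} {c} → c ∈ S → rest (normalise c) ∈ bounds (sign (normalise c)) S
  ∈-bounds⁺ c∈S = ∈-map⁺ (rest ∘ normalise) (∈-filter⁺ (λ c → sign (normalise c) ≟ˢ _) c∈S refl)

  bound-⊢ : ∀ {S : List (Constraint (suc d))} {s c′} → c′ ∈ bounds s S → S ⊢ embed s c′
  bound-⊢ {S} {s} c′∈ with ∈-map⁻ (rest ∘ normalise) c′∈
  ... | c , c∈ , refl with ∈-filter⁻ (λ c → sign (normalise c) ≟ˢ s) {xs = S} c∈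
  ...   | c∈S , refl = normalised-⊢ c∈S

  _+ᶜ_ : Constraint d → Constraint d → Constraint d
  (g , b) +ᶜ (h , c) = g ⊕ h , b + c

  eliminate : List (Constraint (suc d)) → List (Constraint d)
  eliminate S = bounds free S ++ cartesianProductWith _+ᶜ_ (bounds upper S) (bounds lower S)

  eliminate-⊢ : ∀ {S c′} → c′ ∈ eliminate S → S ⊢ embed free c′
  eliminate-⊢ {S} c′∈ with ∈-++⁻ (bounds free S) c′∈
  ... | inj₁ c′∈free = bound-⊢ c′∈free
  ... | inj₂ c′∈pairs with ∈-cartesianProductWith⁻ _+ᶜ_ (bounds upper S) (bounds lower S) c′∈pairs
  ...   | u , l , u∈ , l∈ , refl = cast (add (bound-⊢ u∈) (bound-⊢ l∈)) cancel
    where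
    cancel : (proj₁ (embed upper u) ⊕ proj₁ (embed lower l)) ≐ proj₁ (embed free (u +ᶜ l))
    cancel zero    = ℚ.+-inverseʳ 1ℚ
    cancel (suc i) = refl

  lift-⊢ : ∀ {S : List (Constraint (suc d))} {S′} → (∀ {c′} → c′ ∈ S′ → S ⊢ embed free c′) →
           ∀ {c} → S′ ⊢ c → S ⊢ embed free c
  lift-⊢ S⊢S′ (assumption c∈S′) = S⊢S′ c∈S′
  lift-⊢ S⊢S′ (add ⊢g ⊢h) = cast (add (lift-⊢ S⊢S′ ⊢g) (lift-⊢ S⊢S′ ⊢h)) λ where
    zero    → ℚ.+-identityˡ 0ℚ
    (suc i) → refl
  lift-⊢ S⊢S′ (scale q 0≤q ⊢g) = cast (scale q 0≤q (lift-⊢ S⊢S′ ⊢g)) λ where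
    zero    → ℚ.*-zeroʳ q
    (suc i) → refl
  lift-⊢ S⊢S′ (cast ⊢g g≐g′) = cast (lift-⊢ S⊢S′ ⊢g) λ where
    zero    → refl
    (suc i) → g≐g′ i

between : (us ls : List ℚ) → All (λ u → All (_≤ u) ls) us → ∃[ y ] All (y ≤_) us × All (_≤ y) ls
between []       ls _ = Extrema.max 0ℚ ls , [] , Extrema.xs≤max 0ℚ ls
between (u ∷ us) ls (ls≤u ∷ ls≤us) =
  Extrema.min u us , Extrema.min≤⊤ u us ∷ Extrema.min≤xs u us ,
  All.tabulate λ l∈ls → Extrema.v≤min⁺ (All.lookup ls≤u l∈ls) (All.map (λ ls≤u′ → All.lookup ls≤u′ l∈ls) ls≤us)

module _ {d : ℕ} {S : List (Constraint (suc d))} {y′ : Pt d} (sat : All (Satisfies y′) (eliminate S)) where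
  open Normalised

  private
    U L : Constraint d → ℚ
    U (g , b) = b - dot g y′
    L (g , b) = dot g y′ - b

    lower≤upper : ∀ {u l} → u ∈ bounds upper S → l ∈ bounds lower S → L l ≤ U u
    lower≤upper {gᵤ , bᵤ} {gₗ , bₗ} u∈ l∈ =
      ≤-fromDifference (p≤q⇒0≤q-p (All.lookup sat (∈-++⁺ʳ (bounds free S) (∈-cartesianProductWith⁺ _+ᶜ_ u∈ l∈))))
        (trans (cong (λ D → (bᵤ + bₗ) - D) (dot-⊕ˡ gᵤ gₗ y′))
          (solve 4 (λ bᵤ bₗ dᵤ dₗ → (bᵤ :+ bₗ) :- (dᵤ :+ dₗ) := (bᵤ :- dᵤ) :- (dₗ :- bₗ)) refl bᵤ bₗ (dot gᵤ y′) (dot gₗ y′)))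

    separated : All (λ u → All (_≤ u) (map L (bounds lower S))) (map U (bounds upper S))
    separated = All.map⁺ (All.tabulate λ u∈ → All.map⁺ (All.tabulate λ l∈ → lower≤upper u∈ l∈))

  extend-solution : ∃[ y₀ ] All (Satisfies (cons y₀ y′)) S
  extend-solution = y₀ , All.tabulate λ {c} c∈S →
    normalised-sound (cons y₀ y′) c (at (sign (normalise c)) (∈-bounds⁺ c∈S))
    where
    y₀-between = between (map U (bounds upper S)) (map L (bounds lower S)) separated
    y₀ = proj₁ y₀-between

    at : ∀ s {c′} → c′ ∈ bounds s S → Satisfies (cons y₀ y′) (embed s c′)
    at upper {g , b} c′∈ = ≤-fromDifference (p≤q⇒0≤q-p (All.lookup (All.map⁻ (proj₁ (proj₂ y₀-between))) c′∈))
      (solve 3 (λ b D y → (b :- D) :- y := b :- (con 1ℚ :* y :+ D)) refl b (dot g y′) y₀)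
    at lower {g , b} c′∈ = ≤-fromDifference (p≤q⇒0≤q-p (All.lookup (All.map⁻ (proj₂ (proj₂ y₀-between))) c′∈))
      (solve 3 (λ b D y → y :- (D :- b) := b :- (:- con 1ℚ :* y :+ D)) refl b (dot g y′) y₀)
    at free  {g , b} c′∈ = subst (_≤ b) (solve 2 (λ D y → D := con 0ℚ :* y :+ D) refl (dot g y′) y₀)
      (All.lookup sat (∈-++⁺ˡ c′∈))

fourier-motzkin : ∀ d (S : List (Constraint d)) → Feasible S ⊎ Refutable S
fourier-motzkin zero S with All.all? (λ c → 0ℚ ≤? proj₂ c) S
... | yes 0≤bs = inj₁ ((λ ()) , 0≤bs)
... | no  0≰bs with find (All.¬All⇒Any¬ (λ c → 0ℚ ≤? proj₂ c) S 0≰bs)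
...   | (g , b) , c∈S , 0≰b = inj₂ (b , ℚ.≰⇒> 0≰b , cast (assumption c∈S) λ ())
fourier-motzkin (suc d) S with fourier-motzkin d (eliminate S)
... | inj₁ (y′ , sat) = let y₀ , sat′ = extend-solution sat in inj₁ (cons y₀ y′ , sat′)
... | inj₂ (b , b<0 , ⊢0) = inj₂ (b , b<0 , cast (lift-⊢ eliminate-⊢ ⊢0) λ where
        zero    → refl
        (suc i) → refl)

-- Convex hulls

equation : ∀ {d} → Pt d → ℚ → List (Constraint d)
equation g b = (g , b) ∷ (neg g , - b) ∷ []

equation-sound : ∀ {d} {y g : Pt d} {b} → All (Satisfies y) (equation g b) → dot g y ≡ b
equation-sound {y = y} {g} {b} (g·y≤b ∷ -g·y≤-b ∷ []) = ≤-antisym g·y≤b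
  (≤-fromDifference (p≤q⇒0≤q-p (subst (_≤ - b) (dot-negˡ g y) -g·y≤-b))
    (solve 2 (λ b D → :- b :- (:- D) := D :- b) refl b (dot g y)))

module _ {n d : ℕ} (v : Fin n → Pt d) where

  hull⊆halfspace : ∀ {x} → InConvexHull v x → ∀ c β → (∀ k → dot c (v k) ≤ β) → dot c x ≤ β
  hull⊆halfspace {x} (l , 0≤l , Σl≡1 , x≐) c β c·v≤β = begin
    dot c x                         ≡⟨ trans (dot-congʳ c x≐) (dot-combination c l v) ⟩
    sumℚ (λ m → l m * dot c (v m))  ≤⟨ sumℚ-mono-≤ (λ m → *-monoˡ-≤-0≤ (0≤l m) (c·v≤β m)) ⟩
    sumℚ (λ m → l m * β)            ≡⟨ trans (sumℚ-cong (λ m → ℚ.*-comm (l m) β)) (sumℚ-*ˡ β l) ⟩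
    β * sumℚ l                      ≡⟨ trans (cong (β *_) Σl≡1) (ℚ.*-identityʳ β) ⟩
    β                               ∎
    where open ℚ.≤-Reasoning

  module _ (a : Pt d) where
    private
      nonNegativity coordinates total hullSystem : List (Constraint n)
      nonNegativity = tabulate (λ k → neg (unit k) , 0ℚ)
      coordinates   = concat (tabulate (λ i → equation (λ k → v k i) (a i)))
      total         = equation (λ _ → 1ℚ) 1ℚ
      hullSystem    = nonNegativity ++ coordinates ++ total

      hullSystem-sound : ∀ {l} → All (Satisfies l) hullSystem → InConvexHull v a
      hullSystem-sound {l} sat = l , 0≤l , Σl≡1 , a≐
        where
        sat₁ = All.++⁻ˡ nonNegativity sat
        sat₂ = All.++⁻ˡ coordinates (All.++⁻ʳ nonNegativity sat)
        sat₃ = All.++⁻ʳ coordinates (All.++⁻ʳ nonNegativity sat)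

        0≤l : ∀ k → 0ℚ ≤ l k
        0≤l k = ≤-fromDifference (p≤q⇒0≤q-p (subst (_≤ 0ℚ) (trans (dot-negˡ (unit k) l) (cong -_ (dot-unitˡ k l)))
                                                         (All.tabulate⁻ sat₁ k)))
                  (solve 1 (λ x → con 0ℚ :- (:- x) := x :- con 0ℚ) refl (l k))

        Σl≡1 : sumℚ l ≡ 1ℚ
        Σl≡1 = trans (sym (trans (dot≡sumℚ (λ _ → 1ℚ) l) (sumℚ-cong (λ k → ℚ.*-identityˡ (l k)))))
                     (equation-sound sat₃)

        a≐ : a ≐ sumPt (λ m → l m ⊛ v m)
        a≐ i = sym (trans (sym (trans (dot≡sumℚ (λ k → v k i) l) (sumℚ-cong (λ k → ℚ.*-comm (v k i) (l k)))))
                          (equation-sound (All.tabulate⁻ (All.concat⁻ sat₂) i)))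

      -- Every inequality derivable from the hull system is dominated by an affine function
      -- ⟨u , _⟩ + w, evaluated at the generators and at a; a refutation thus gives a separating one.
      Majorised : Constraint n → Set
      Majorised (h , β) = ∃[ u ] ∃[ w ] (∀ k → h k ≤ dot u (v k) + w) × dot u a + w ≤ β

      majorised-⊢ : ∀ {S c} → All Majorised S → S ⊢ c → Majorised c
      majorised-⊢ maj (assumption c∈S) = All.lookup maj c∈S
      majorised-⊢ maj (add {g} {h} {b} {c} ⊢g ⊢h) with majorised-⊢ maj ⊢g | majorised-⊢ maj ⊢h
      ... | u , w , g≤ , b≥ | u′ , w′ , h≤ , c≥ = u ⊕ u′ , w + w′ , g+h≤ , ≤-trans (ℚ.≤-reflexive (sum a)) (ℚ.+-mono-≤ b≥ c≥)
        where
        sum : ∀ x → dot (u ⊕ u′) x + (w + w′) ≡ (dot u x + w) + (dot u′ x + w′)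
        sum x = trans (cong (_+ (w + w′)) (dot-⊕ˡ u u′ x))
                      (solve 4 (λ p q w w′ → (p :+ q) :+ (w :+ w′) := (p :+ w) :+ (q :+ w′)) refl (dot u x) (dot u′ x) w w′)
        g+h≤ : ∀ k → g k + h k ≤ dot (u ⊕ u′) (v k) + (w + w′)
        g+h≤ k = ≤-trans (ℚ.+-mono-≤ (g≤ k) (h≤ k)) (ℚ.≤-reflexive (sym (sum (v k))))
      majorised-⊢ maj (scale {g} {b} q 0≤q ⊢g) with majorised-⊢ maj ⊢g
      ... | u , w , g≤ , b≥ = q ⊛ u , q * w , q*g≤ , ≤-trans (ℚ.≤-reflexive (scaled a)) (*-monoˡ-≤-0≤ 0≤q b≥)
        where
        scaled : ∀ x → dot (q ⊛ u) x + q * w ≡ q * (dot u x + w)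
        scaled x = trans (cong (_+ q * w) (dot-⊛ˡ q u x)) (sym (ℚ.*-distribˡ-+ q (dot u x) w))
        q*g≤ : ∀ k → q * g k ≤ dot (q ⊛ u) (v k) + q * w
        q*g≤ k = ≤-trans (*-monoˡ-≤-0≤ 0≤q (g≤ k)) (ℚ.≤-reflexive (sym (scaled (v k))))
      majorised-⊢ maj (cast ⊢g g≐g′) with majorised-⊢ maj ⊢g
      ... | u , w , g≤ , b≥ = u , w , (λ k → subst (_≤ _) (g≐g′ k) (g≤ k)) , b≥

      majorised-equation : ∀ {g b} u w → (∀ k → g k ≡ dot u (v k) + w) → dot u a + w ≡ b →
                           All Majorised (equation g b)
      majorised-equation u w g≡ b≡ =
          (u , w , (λ k → ℚ.≤-reflexive (g≡ k)) , ℚ.≤-reflexive b≡)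
        ∷ (neg u , - w , (λ k → ℚ.≤-reflexive (negated (g≡ k))) , ℚ.≤-reflexive (sym (negated (sym b≡))))
        ∷ []
        where
        negated : ∀ {x p} → p ≡ dot u x + w → - p ≡ dot (neg u) x + - w
        negated {x} refl = trans (ℚ.neg-distrib-+ (dot u x) w) (cong (_+ - w) (sym (dot-negˡ u x)))

      dot-origin+ : ∀ (x : Pt d) w → dot origin x + w ≡ w
      dot-origin+ x w = trans (cong (_+ w) (dot-originˡ x)) (ℚ.+-identityˡ w)

      majorised-hullSystem : All Majorised hullSystem
      majorised-hullSystem = All.++⁺ (All.tabulate⁺ nonNeg) (All.++⁺ (All.concat⁺ (All.tabulate⁺ coordinate)) normalisation)
        where
        nonNeg : ∀ k → Majorised (neg (unit k) , 0ℚ)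
        nonNeg k = origin , 0ℚ ,
          (λ j → ≤-trans (ℚ.neg-antimono-≤ (0≤unit k j)) (ℚ.≤-reflexive (sym (dot-origin+ (v j) 0ℚ)))) ,
          ℚ.≤-reflexive (dot-origin+ a 0ℚ)
        coordinate : ∀ i → All Majorised (equation (λ k → v k i) (a i))
        coordinate i = majorised-equation (unit i) 0ℚ
          (λ k → sym (trans (ℚ.+-identityʳ _) (dot-unitˡ i (v k))))
          (trans (ℚ.+-identityʳ _) (dot-unitˡ i a))
        normalisation : All Majorised total
        normalisation = majorised-equation origin 1ℚ (λ k → sym (dot-origin+ (v k) 1ℚ)) (dot-origin+ a 1ℚ)

    hull-by-halfspaces : (∀ c β → (∀ k → dot c (v k) ≤ β) → dot c a ≤ β) → InConvexHull v a
    hull-by-halfspaces inHalfspaces with fourier-motzkin n hullSystem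
    ... | inj₁ (l , sat) = hullSystem-sound sat
    ... | inj₂ (b , b<0 , ⊢0) with majorised-⊢ majorised-hullSystem ⊢0
    ...   | u , w , 0≤u·v+w , u·a+w≤b = contradiction (≤-<-trans 0≤u·a+w (≤-<-trans u·a+w≤b b<0)) (ℚ.<-irrefl refl)
      where
      reflect : ∀ x → dot u x + w ≡ w - dot (neg u) x
      reflect x = trans (solve 2 (λ D w → D :+ w := w :- (:- D)) refl (dot u x) w)
                        (cong (λ D → w - D) (sym (dot-negˡ u x)))
      0≤u·a+w : 0ℚ ≤ dot u a + w
      0≤u·a+w = subst (0ℚ ≤_) (sym (reflect a)) (p≤q⇒0≤q-p
        (inHalfspaces (neg u) w (λ k → ≤-fromDifference (0≤u·v+w k) (reflect (v k)))))

  hull-generator : ∀ m → InConvexHull v (v m)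
  hull-generator m = unit m , 0≤unit m , sumℚ-unit≡1 m , λ i → sym (sumℚ-unit m (λ k → v k i))

  hull-peel : ∀ {x} (x∈hull : InConvexHull v x) m {t} → t ≤ proj₁ x∈hull m → t < 1ℚ →
              ∃[ z ] InConvexHull v z × x ≐ ((t ⊛ v m) ⊕ ((1ℚ - t) ⊛ z))
  hull-peel {x} (l , 0≤l , Σl≡1 , x≐) m {t} t≤lₘ t<1 = z , (μ , 0≤μ , Σμ≡1 , λ i → refl) , x≐split
    where
    r-reciprocal = reciprocal (p<q⇒0<q-p t<1)
    r = proj₁ r-reciprocal
    0≤r = <⇒≤ (proj₁ (proj₂ r-reciprocal))
    [1-t]r≡1 = proj₂ (proj₂ r-reciprocal)

    μ : Fin n → ℚ
    μ k = r * (l k - t * unit m k)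

    0≤μ : ∀ k → 0ℚ ≤ μ k
    0≤μ k with m ≟ k
    ... | yes refl = 0≤* 0≤r (subst (λ u → 0ℚ ≤ l m - t * u) (sym (unit-same m))
                               (subst (λ p → 0ℚ ≤ l m - p) (sym (ℚ.*-identityʳ t)) (p≤q⇒0≤q-p t≤lₘ)))
    ... | no m≢k   = 0≤* 0≤r (subst (0ℚ ≤_) (sym (trans (cong (λ u → l k - t * u) (unit-diff m≢k))
                                                         (solve 2 (λ x t → x :- t :* con 0ℚ := x) refl (l k) t)))
                                   (0≤l k))

    Σμ≡1 : sumℚ μ ≡ 1ℚ
    Σμ≡1 = begin
      sumℚ μ                               ≡⟨ sumℚ-*ˡ r (λ k → l k - t * unit m k) ⟩
      r * sumℚ (λ k → l k - t * unit m k)  ≡⟨ cong (r *_) (sumℚ-linear l (unit m) t) ⟩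
      r * (sumℚ l - t * sumℚ (unit m))     ≡⟨ cong₂ (λ a b → r * (a - t * b)) Σl≡1 (sumℚ-unit≡1 m) ⟩
      r * (1ℚ - t * 1ℚ)                    ≡⟨ cong (λ s → r * (1ℚ - s)) (ℚ.*-identityʳ t) ⟩
      r * (1ℚ - t)                         ≡⟨ ℚ.*-comm r (1ℚ - t) ⟩
      (1ℚ - t) * r                         ≡⟨ [1-t]r≡1 ⟩
      1ℚ                                   ∎
      where open ≡-Reasoning

    z : Pt d
    z = sumPt (λ k → μ k ⊛ v k)

    x≐split : x ≐ ((t ⊛ v m) ⊕ ((1ℚ - t) ⊛ z))
    x≐split i = trans (x≐ i) (sym (sumℚ-peel l (λ k → v k i) m {t} {r} [1-t]r≡1))

  -- Peeling off half of a positive weight l m writes x as a proper convex combination of v m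
  -- and another point of the hull, so an extreme point x must equal v m.
  vertex∈generators : ∀ {P : Region d} {x} → (∀ {z} → InConvexHull v z → P z) →
                      IsVertex P x → InConvexHull v x → ∃[ m ] v m ≐ x
  vertex∈generators hull⊆P (_ , extreme) x∈hull@(l , 0≤l , Σl≡1 , _) =
    m , extreme (v m) (proj₁ peeled) t (hull⊆P (hull-generator m)) (hull⊆P (proj₁ (proj₂ peeled))) 0<t t<1
                (proj₂ (proj₂ peeled))
    where
    m-positive = 0<sumℚ⇒∃0< l (subst (0ℚ <_) (sym Σl≡1) 0<1)
    m = proj₁ m-positive
    t = ½ * l m

    0<t : 0ℚ < t
    0<t = 0<* 0<½ (proj₂ m-positive)

    t≤lₘ : t ≤ l m
    t≤lₘ = ≤-fromDifference (<⇒≤ 0<t) (solve 1 (λ x → con ½ :* x := x :- con ½ :* x) refl (l m))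

    t<1 : t < 1ℚ
    t<1 = ≤-<-trans (*-monoˡ-≤-0≤ (<⇒≤ 0<½) (subst (l m ≤_) Σl≡1 (term≤sumℚ 0≤l m)))
                      (subst (_< 1ℚ) (sym (ℚ.*-identityʳ ½)) ½<1)

    peeled = hull-peel x∈hull m t≤lₘ t<1

tight-constituent : ∀ {d} {P : Region d} {x y z q : Pt d} {t} → Dual P y → Dual P z → 0ℚ < t → t < 1ℚ →
                    x ≐ ((t ⊛ y) ⊕ ((1ℚ - t) ⊛ z)) → P q → dot x q ≡ 1ℚ → dot y q ≡ 1ℚ
tight-constituent {x = x} {y} {z} {q} {t} y∈dual z∈dual 0<t t<1 x≐ q∈P x·q≡1 =
  ≤-antisym (y∈dual q q∈P) (*-cancelˡ-≤-0< 0<t (≤-fromDifference (p≤q⇒0≤q-p 1≤) (solve 2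
    (λ t Y → (t :* Y :+ (con 1ℚ :- t) :* con 1ℚ) :- con 1ℚ := t :* Y :- t :* con 1ℚ) refl t (dot y q))))
  where
  x·q≡ : dot x q ≡ t * dot y q + (1ℚ - t) * dot z q
  x·q≡ = trans (dot-congˡ q x≐) (trans (dot-⊕ˡ (t ⊛ y) ((1ℚ - t) ⊛ z) q)
           (cong₂ _+_ (dot-⊛ˡ t y q) (dot-⊛ˡ (1ℚ - t) z q)))
  1≤ : 1ℚ ≤ t * dot y q + (1ℚ - t) * 1ℚ
  1≤ = subst (_≤ t * dot y q + (1ℚ - t) * 1ℚ) (trans (sym x·q≡) x·q≡1)
         (ℚ.+-monoʳ-≤ (t * dot y q) (*-monoˡ-≤-0≤ (<⇒≤ (p<q⇒0<q-p t<1)) (z∈dual q q∈P)))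

interior⇒axis-steps : ∀ {d} {P : Region d} {x} → Interior P x →
  ∃[ δ ] 0ℚ < δ × (∀ i → P (x ⊕ (δ ⊛ unit i)) × P (x ⊕ ((- δ) ⊛ unit i)))
interior⇒axis-steps {x = x} (ε , 0<ε , ball) =
  δ , 0<δ , λ i → ball _ (near δ ∣δ∣<ε i) , ball _ (near (- δ) (subst (_< ε) (sym (ℚ.∣-p∣≡∣p∣ δ)) ∣δ∣<ε) i)
  where
  δ = ½ * ε
  0<δ : 0ℚ < δ
  0<δ = 0<* 0<½ 0<ε
  ∣δ∣<ε : ∣ δ ∣ < ε
  ∣δ∣<ε = subst (_< ε) (sym (ℚ.0≤p⇒∣p∣≡p (<⇒≤ 0<δ)))
            (<-fromDifference 0<δ (solve 1 (λ e → con ½ :* e := e :- con ½ :* e) refl ε))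
  near : ∀ s → ∣ s ∣ < ε → ∀ i m → ∣ (x ⊕ (s ⊛ unit i)) m - x m ∣ < ε
  near s ∣s∣<ε i m = subst (λ p → ∣ p ∣ < ε) (solve 2 (λ a b → b := (a :+ b) :- a) refl (x m) (s * unit i m)) small
    where
    small : ∣ s * unit i m ∣ < ε
    small with i ≟ m
    ... | yes refl = subst (λ u → ∣ s * u ∣ < ε) (sym (unit-same i)) (subst (λ p → ∣ p ∣ < ε) (sym (ℚ.*-identityʳ s)) ∣s∣<ε)
    ... | no  i≢m  = subst (λ u → ∣ s * u ∣ < ε) (sym (unit-diff i≢m))
                       (subst (λ p → ∣ p ∣ < ε) (sym (ℚ.*-zeroʳ s)) (≤-<-trans (ℚ.0≤∣p∣ s) ∣s∣<ε))

ι : ℤ → ℚ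
ι z = z / 1

ι≡mkℚ : ∀ z → ι z ≡ mkℚ z 0 (Coprimality.sym (Coprimality.1-coprimeTo ℤ.∣ z ∣))
ι≡mkℚ (+ n)    = ℚ.normalize-coprime (Coprimality.sym (Coprimality.1-coprimeTo n))
ι≡mkℚ -[1+ n ] = cong -_ (ℚ.normalize-coprime (Coprimality.sym (Coprimality.1-coprimeTo (suc n))))

toℚᵘ-ι : ∀ z → toℚᵘ (ι z) ℚᵘ.≃ mkℚᵘ z 0
toℚᵘ-ι z rewrite ι≡mkℚ z = *≡* refl

ι-mono-≤ : ∀ {a b} → a ℤ.≤ b → ι a ≤ ι b
ι-mono-≤ {a} {b} a≤b rewrite ι≡mkℚ a | ι≡mkℚ b =
  *≤* (subst₂ ℤ._≤_ (sym (ℤ.*-identityʳ a)) (sym (ℤ.*-identityʳ b)) a≤b)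

ι-mono-< : ∀ {a b} → a ℤ.< b → ι a < ι b
ι-mono-< {a} {b} a<b rewrite ι≡mkℚ a | ι≡mkℚ b =
  *<* (subst₂ ℤ._<_ (sym (ℤ.*-identityʳ a)) (sym (ℤ.*-identityʳ b)) a<b)

ι-cancel-≤ : ∀ {a b} → ι a ≤ ι b → a ℤ.≤ b
ι-cancel-≤ {a} {b} ιa≤ιb rewrite ι≡mkℚ a | ι≡mkℚ b with ιa≤ιb
... | *≤* a*1≤b*1 = subst₂ ℤ._≤_ (ℤ.*-identityʳ a) (ℤ.*-identityʳ b) a*1≤b*1

ι-cancel-< : ∀ {a b} → ι a < ι b → a ℤ.< b
ι-cancel-< {a} {b} ιa<ιb rewrite ι≡mkℚ a | ι≡mkℚ b with ιa<ιb
... | *<* a*1<b*1 = subst₂ ℤ._<_ (ℤ.*-identityʳ a) (ℤ.*-identityʳ b) a*1<b*1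

module _ where
  open ℚᵘ.≃-Reasoning

  ι-+ : ∀ a b → ι (a ℤ.+ b) ≡ ι a + ι b
  ι-+ a b = ℚ.toℚᵘ-injective (begin
    toℚᵘ (ι (a ℤ.+ b))             ≈⟨ toℚᵘ-ι (a ℤ.+ b) ⟩
    mkℚᵘ (a ℤ.+ b) 0               ≈⟨ *≡* (trans (ℤ.*-identityʳ _) (sym (trans (ℤ.*-identityʳ _)
                                         (cong₂ ℤ._+_ (ℤ.*-identityʳ a) (ℤ.*-identityʳ b))))) ⟩
    mkℚᵘ a 0 ℚᵘ.+ mkℚᵘ b 0         ≈⟨ ℚᵘ.+-cong (ℚᵘ.≃-sym (toℚᵘ-ι a)) (ℚᵘ.≃-sym (toℚᵘ-ι b)) ⟩
    toℚᵘ (ι a) ℚᵘ.+ toℚᵘ (ι b)     ≈⟨ ℚᵘ.≃-sym (ℚ.toℚᵘ-homo-+ (ι a) (ι b)) ⟩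
    toℚᵘ (ι a + ι b)               ∎)

  ι-* : ∀ a b → ι (a ℤ.* b) ≡ ι a * ι b
  ι-* a b = ℚ.toℚᵘ-injective (begin
    toℚᵘ (ι (a ℤ.* b))             ≈⟨ toℚᵘ-ι (a ℤ.* b) ⟩
    mkℚᵘ (a ℤ.* b) 0               ≈⟨ ℚᵘ.≃-refl ⟩
    mkℚᵘ a 0 ℚᵘ.* mkℚᵘ b 0         ≈⟨ ℚᵘ.*-cong (ℚᵘ.≃-sym (toℚᵘ-ι a)) (ℚᵘ.≃-sym (toℚᵘ-ι b)) ⟩
    toℚᵘ (ι a) ℚᵘ.* toℚᵘ (ι b)     ≈⟨ ℚᵘ.≃-sym (ℚ.toℚᵘ-homo-* (ι a) (ι b)) ⟩
    toℚᵘ (ι a * ι b)               ∎)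

  ι-neg : ∀ a → ι (ℤ.- a) ≡ - ι a
  ι-neg a = ℚ.toℚᵘ-injective (begin
    toℚᵘ (ι (ℤ.- a))               ≈⟨ toℚᵘ-ι (ℤ.- a) ⟩
    mkℚᵘ (ℤ.- a) 0                 ≈⟨ ℚᵘ.-‿cong (ℚᵘ.≃-sym (toℚᵘ-ι a)) ⟩
    ℚᵘ.- toℚᵘ (ι a)                ≈⟨ ℚᵘ.≃-sym (ℚ.toℚᵘ-homo‿- (ι a)) ⟩
    toℚᵘ (- ι a)                   ∎)

  ι-numerator : ∀ p → ι (↥ p) ≡ ι (+ ↧ₙ p) * p
  ι-numerator p@(mkℚ n d-1 _) = ℚ.toℚᵘ-injective (begin
    toℚᵘ (ι n)                     ≈⟨ toℚᵘ-ι n ⟩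
    mkℚᵘ n 0                       ≈⟨ *≡* (trans (cong (λ m → n ℤ.* + m) (ℕ.*-identityˡ (suc d-1)))
                                         (trans (ℤ.*-comm n (+ suc d-1)) (sym (ℤ.*-identityʳ _)))) ⟩
    mkℚᵘ (+ suc d-1) 0 ℚᵘ.* toℚᵘ p ≈⟨ ℚᵘ.*-cong (ℚᵘ.≃-sym (toℚᵘ-ι (+ suc d-1))) ℚᵘ.≃-refl ⟩
    toℚᵘ (ι (+ suc d-1)) ℚᵘ.* toℚᵘ p ≈⟨ ℚᵘ.≃-sym (ℚ.toℚᵘ-homo-* (ι (+ suc d-1)) p) ⟩
    toℚᵘ (ι (+ suc d-1) * p)       ∎)

ι-suc : ∀ a → ι (ℤ.suc a) ≡ ι a + 1ℚ
ι-suc a = trans (ι-+ 1ℤ a) (ℚ.+-comm 1ℚ (ι a))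

ι-characterisation : (f : ℤ → ℚ) → f 0ℤ ≡ 0ℚ → (∀ a → f (ℤ.suc a) ≡ f a + 1ℚ) → ∀ a → f a ≡ ι a
ι-characterisation f f0 f-suc (+ zero)  = f0
ι-characterisation f f0 f-suc (+ suc n) =
  trans (f-suc (+ n)) (trans (cong (_+ 1ℚ) (ι-characterisation f f0 f-suc (+ n))) (sym (ι-suc (+ n))))
ι-characterisation f f0 f-suc -[1+ n ] =
  cancel (trans (sym (f-suc -[1+ n ])) (trans (at-successor n) (ι-suc -[1+ n ])))
  where
  at-successor : ∀ n → f (ℤ.suc -[1+ n ]) ≡ ι (ℤ.suc -[1+ n ])
  at-successor zero    = f0
  at-successor (suc n) = ι-characterisation f f0 f-suc -[1+ n ]
  cancel : ∀ {p q} → p + 1ℚ ≡ q + 1ℚ → p ≡ q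
  cancel {p} {q} e = trans (solve 1 (λ p → p := (p :+ con 1ℚ) :- con 1ℚ) refl p)
                           (trans (cong (_- 1ℚ) e) (solve 1 (λ q → (q :+ con 1ℚ) :- con 1ℚ := q) refl q))

sumℚ-const : ∀ n c → sumℚ {n} (λ _ → c) ≡ ι (+ n) * c
sumℚ-const zero    c = sym (ℚ.*-zeroˡ c)
sumℚ-const (suc n) c = begin
  c + sumℚ {n} (λ _ → c)  ≡⟨ cong (λ s → c + s) (sumℚ-const n c) ⟩
  c + ι (+ n) * c         ≡⟨ solve 2 (λ c m → c :+ m :* c := (con 1ℚ :+ m) :* c) refl c (ι (+ n)) ⟩
  (1ℚ + ι (+ n)) * c      ≡⟨ cong (_* c) (sym (ι-+ 1ℤ (+ n))) ⟩
  ι (+ suc n) * c         ∎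
  where open ≡-Reasoning

-1<ι⇒0≤ι : ∀ z → - 1ℚ < ι z → 0ℚ ≤ ι z
-1<ι⇒0≤ι z -1<z = ι-mono-≤ {0ℤ} {z} (ℤ.i<j⇒suc[i]≤j (ι-cancel-< { -1ℤ} {z} -1<z))

ι<1⇒ι≤0 : ∀ z → ι z < 1ℚ → ι z ≤ 0ℚ
ι<1⇒ι≤0 z z<1 = ι-mono-≤ {z} {0ℤ} (ℤ.i<j⇒i≤pred[j] (ι-cancel-< {z} {1ℤ} z<1))

commonDenominator : ∀ {d} (x : Pt d) → ∃[ n ] Σ (Fin d → ℤ) λ A → ∀ i → ι (A i) ≡ ι (+ suc n) * x i
commonDenominator {zero}  x = 0 , (λ ()) , (λ ())
commonDenominator {suc d} x with commonDenominator (x ∘ suc)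
... | n , A , A≡ = n ℕ.+ e ℕ.* suc n , A′ , A′≡
  where
  e = ℚ.denominator-1 (x zero)
  D = ι (+ suc e)
  M = ι (+ suc n)
  N≡ : ι (+ suc (n ℕ.+ e ℕ.* suc n)) ≡ D * M
  N≡ = trans (cong ι (ℤ.pos-* (suc e) (suc n))) (ι-* (+ suc e) (+ suc n))
  A′ : Fin (suc d) → ℤ
  A′ zero    = + suc n ℤ.* ↥ x zero
  A′ (suc i) = + suc e ℤ.* A i
  A′≡ : ∀ i → ι (A′ i) ≡ ι (+ suc (n ℕ.+ e ℕ.* suc n)) * x i
  A′≡ zero    = trans (ι-* (+ suc n) (↥ x zero)) (trans (cong (M *_) (ι-numerator (x zero)))
                  (trans (solve 3 (λ m d p → m :* (d :* p) := (d :* m) :* p) refl M D (x zero)) (cong (_* x zero) (sym N≡))))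
  A′≡ (suc i) = trans (ι-* (+ suc e) (A i)) (trans (cong (D *_) (A≡ i))
                  (trans (sym (ℚ.*-assoc D M (x (suc i)))) (cong (_* x (suc i)) (sym N≡))))

∈⇒lookup : ∀ {A : Set} {xs : List A} {x} → x ∈ xs → ∃[ k ] lookup xs k ≡ x
∈⇒lookup x∈xs = Any.index x∈xs , sym (lookup-index x∈xs)

lattice-cong : ∀ {d} {x y : Pt d} → x ≐ y → IsLatticePoint x → IsLatticePoint y
lattice-cong x≐y x-lattice i with x-lattice i
... | z , x≡z = z , trans (sym (x≐y i)) x≡z

lattice-unit : ∀ {d} (i : Fin d) → IsLatticePoint (unit i)
lattice-unit i k with i ≟ k
... | yes refl = + 1 , unit-same i
... | no  i≢k  = 0ℤ , unit-diff i≢k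

lattice-⊕ : ∀ {d} {x y : Pt d} → IsLatticePoint x → IsLatticePoint y → IsLatticePoint (x ⊕ y)
lattice-⊕ x-lattice y-lattice i with x-lattice i | y-lattice i
... | a , x≡a | b , y≡b = a ℤ.+ b , trans (cong₂ _+_ x≡a y≡b) (sym (ι-+ a b))

lattice-neg : ∀ {d} {x : Pt d} → IsLatticePoint x → IsLatticePoint (neg x)
lattice-neg x-lattice i with x-lattice i
... | a , x≡a = ℤ.- a , trans (cong -_ x≡a) (sym (ι-neg a))

smallIntegers : List ℚ
smallIntegers = - 1ℚ ∷ 0ℚ ∷ 1ℚ ∷ (1ℚ + 1ℚ) ∷ []

box : ∀ d → List (Pt d)
box zero    = (λ ()) ∷ []
box (suc d) = cartesianProductWith cons smallIntegers (box d)

integer∈smallIntegers : ∀ z → - 1ℚ ≤ ι z → ι z ≤ 1ℚ + 1ℚ → ι z ∈ smallIntegers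
integer∈smallIntegers z -1≤z z≤2 = go z (ι-cancel-≤ { -1ℤ} {z} -1≤z) (ι-cancel-≤ {z} {+ 2} z≤2)
  where
  go : ∀ z → -1ℤ ℤ.≤ z → z ℤ.≤ + 2 → ι z ∈ smallIntegers
  go -[1+ 0 ]         _            _ = here refl
  go -[1+ suc n ]     (ℤ.-≤- ())   _
  go (+ 0)            _            _ = there (here refl)
  go (+ 1)            _            _ = there (there (here refl))
  go (+ 2)            _            _ = there (there (there (here refl)))
  go (+ suc (suc (suc n))) _ (ℤ.+≤+ (ℕ.s≤s (ℕ.s≤s ())))

smallInteger-integral : ∀ {v} → v ∈ smallIntegers → ∃[ z ] v ≡ ι z
smallInteger-integral (here refl)                         = -1ℤ , refl
smallInteger-integral (there (here refl))                 = 0ℤ , refl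
smallInteger-integral (there (there (here refl)))         = + 1 , refl
smallInteger-integral (there (there (there (here refl)))) = + 2 , refl

∈-box : ∀ {d} (x : Pt d) → (∀ i → x i ∈ smallIntegers) → ∃[ q ] q ∈ box d × q ≐ x
∈-box {zero}  x _ = (λ ()) , here refl , λ ()
∈-box {suc d} x x∈smallIntegers with ∈-box (x ∘ suc) (x∈smallIntegers ∘ suc)
... | q , q∈box , q≐x = cons (x zero) q , ∈-cartesianProductWith⁺ cons (x∈smallIntegers zero) q∈box , λ where
  zero    → refl
  (suc i) → q≐x i

box-lattice : ∀ {d} {p : Pt d} → p ∈ box d → IsLatticePoint p
box-lattice {zero}  _ ()
box-lattice {suc d} p∈box with ∈-cartesianProductWith⁻ cons smallIntegers (box d) p∈box
... | v , q , v∈smallIntegers , q∈box , refl = λ where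
  zero    → smallInteger-integral v∈smallIntegers
  (suc i) → box-lattice q∈box i

-- Floor division and Hermite's identity

module Floor (N : ℕ) .{{_ : ℕ.NonZero N}} where

  ⌊_/N⌋ : ℤ → ℤ
  ⌊ a /N⌋ = a ℤ./ℕ N

  ⌊/N⌋≤ : ∀ {q a} → a ℤ.< ℤ.suc q ℤ.* + N → ⌊ a /N⌋ ℤ.≤ q
  ⌊/N⌋≤ {q} {a} a<[q+1]N = subst (⌊ a /N⌋ ℤ.≤_) (ℤ.pred-suc q)
    (ℤ.i<j⇒i≤pred[j] (ℤ.*-cancelʳ-<-nonNeg {⌊ a /N⌋} {ℤ.suc q} (+ N) (ℤ.≤-<-trans (ℤ.[n/ℕd]*d≤n a N) a<[q+1]N)))

  ⌊/N⌋-shift : ∀ {a b} m → a ℤ.≤ b ℤ.+ m ℤ.* + N → ⌊ a /N⌋ ℤ.≤ ⌊ b /N⌋ ℤ.+ m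
  ⌊/N⌋-shift {a} {b} m a≤b+mN = ⌊/N⌋≤ (ℤ.≤-<-trans a≤b+mN (ℤ.<-≤-trans
    (ℤ.+-monoˡ-< (m ℤ.* + N) (ℤ.n<s[n/ℕd]*d b N))
    (ℤ.≤-reflexive (trans (sym (ℤ.*-distribʳ-+ (+ N) (ℤ.suc ⌊ b /N⌋) m)) (cong (ℤ._* + N) (ℤ.+-assoc 1ℤ ⌊ b /N⌋ m))))))

  ι⌊/N⌋-shift : ∀ {a b} m → ι a ≤ ι b + ι m * ι (+ N) → ι ⌊ a /N⌋ ≤ ι ⌊ b /N⌋ + ι m
  ι⌊/N⌋-shift {a} {b} m ιa≤ = subst (ι ⌊ a /N⌋ ≤_) (ι-+ ⌊ b /N⌋ m) (ι-mono-≤ (⌊/N⌋-shift {a} {b} m (ι-cancel-≤ {a} {b ℤ.+ m ℤ.* + N}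
    (subst (ι a ≤_) (sym (trans (ι-+ b (m ℤ.* + N)) (cong (λ p → ι b + p) (ι-* m (+ N))))) ιa≤))))

  ⌊k/N⌋≡0 : ∀ {k} → k ℕ.< N → ⌊ + k /N⌋ ≡ 0ℤ
  ⌊k/N⌋≡0 k<N = cong +_ (ℕ.m<n⇒m/n≡0 k<N)

  ι⌊a+N/N⌋ : ∀ a → ι ⌊ a ℤ.+ + N /N⌋ ≡ ι ⌊ a /N⌋ + 1ℚ
  ι⌊a+N/N⌋ a = ≤-antisym
    (ι⌊/N⌋-shift {a ℤ.+ + N} {a} 1ℤ (ℚ.≤-reflexive (trans (ι-+ a (+ N)) (cong (λ p → ι a + p) (sym (ℚ.*-identityˡ (ι (+ N))))))))
    (≤-fromDifference (p≤q⇒0≤q-p (ι⌊/N⌋-shift {a} {a ℤ.+ + N} -1ℤ (ℚ.≤-reflexive (trans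
        (solve 2 (λ a n → a := (a :+ n) :+ :- con 1ℚ :* n) refl (ι a) (ι (+ N))) (cong (λ p → p + - 1ℚ * ι (+ N)) (sym (ι-+ a (+ N))))))))
      (solve 2 (λ f g → (g :+ :- con 1ℚ) :- f := g :- (f :+ con 1ℚ)) refl (ι ⌊ a /N⌋) (ι ⌊ a ℤ.+ + N /N⌋)))

  hermite : ∀ a → sumℚ {N} (λ k → ι ⌊ a ℤ.+ + toℕ k /N⌋) ≡ ι a
  hermite = ι-characterisation H H0 H-suc
    where
    g : ℤ → ℕ → ℚ
    g a j = ι ⌊ a ℤ.+ + j /N⌋
    H : ℤ → ℚ
    H a = sumℚ {N} (λ k → g a (toℕ k))
    H0 : H 0ℤ ≡ 0ℚ
    H0 = sumℚ-zero {N} (λ k → cong ι (⌊k/N⌋≡0 (toℕ<n k)))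
    gN : ∀ a → g a N ≡ g a 0 + 1ℚ
    gN a = trans (ι⌊a+N/N⌋ a) (cong (λ b → ι ⌊ b /N⌋ + 1ℚ) (sym (ℤ.+-identityʳ a)))
    H-suc : ∀ a → H (ℤ.suc a) ≡ H a + 1ℚ
    H-suc a = begin
      H (ℤ.suc a)                                      ≡⟨ sumℚ-cong {N} (λ k → cong (λ b → ι ⌊ b /N⌋) (shift (+ toℕ k))) ⟩
      S₁                                               ≡⟨ solve 2 (λ s g → s := (s :+ g) :- g) refl S₁ (g a 0) ⟩
      (S₁ + g a 0) - g a 0                             ≡⟨ cong (_- g a 0) (sumℚ-telescope N (g a)) ⟩
      (H a + g a N) - g a 0                            ≡⟨ cong (λ x → (H a + x) - g a 0) (gN a) ⟩
      (H a + (g a 0 + 1ℚ)) - g a 0                     ≡⟨ solve 2 (λ h g → (h :+ (g :+ con 1ℚ)) :- g := h :+ con 1ℚ) refl (H a) (g a 0) ⟩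
      H a + 1ℚ                                         ∎
      where
      open ≡-Reasoning
      S₁ = sumℚ {N} (λ k → g a (suc (toℕ k)))
      shift : ∀ k → ℤ.suc a ℤ.+ k ≡ a ℤ.+ ℤ.suc k
      shift k = trans (cong (ℤ._+ k) (ℤ.+-comm 1ℤ a)) (ℤ.+-assoc a 1ℤ k)

  -- round true a k = ⌊(a + k)/N⌋ and round false a k = ⌈(a − k)/N⌉.
  round : Bool → ℤ → ℕ → ℤ
  round true  a k = ⌊ a ℤ.+ + k /N⌋
  round false a k = ℤ.- ⌊ ℤ.- a ℤ.+ + k /N⌋

  private
    ι⌊k/N⌋≡0 : ∀ {k} → k ℕ.< N → ι ⌊ + k /N⌋ ≡ 0ℚ
    ι⌊k/N⌋≡0 k<N = cong ι (⌊k/N⌋≡0 k<N)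

  round-lower : ∀ b {a k} → - ι (+ N) ≤ ι a → k ℕ.< N → - 1ℚ ≤ ι (round b a k)
  round-lower true {a} {k} -N≤a k<N = ≤-fromDifference (p≤q⇒0≤q-p shifted)
    (solve 1 (λ f → (f :+ con 1ℚ) :- con 0ℚ := f :- :- con 1ℚ) refl (ι ⌊ a ℤ.+ + k /N⌋))
    where
    shifted : 0ℚ ≤ ι ⌊ a ℤ.+ + k /N⌋ + 1ℚ
    shifted = subst (_≤ ι ⌊ a ℤ.+ + k /N⌋ + 1ℚ) (ι⌊k/N⌋≡0 k<N) (ι⌊/N⌋-shift {+ k} {a ℤ.+ + k} 1ℤ (≤-fromDifference (p≤q⇒0≤q-p -N≤a)
      (trans (solve 3 (λ a k n → a :- :- n := ((a :+ k) :+ con 1ℚ :* n) :- k) refl (ι a) (ι (+ k)) (ι (+ N)))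
             (cong (λ p → (p + 1ℚ * ι (+ N)) - ι (+ k)) (sym (ι-+ a (+ k)))))))
  round-lower false {a} {k} -N≤a k<N = subst (- 1ℚ ≤_) (sym (ι-neg ⌊ ℤ.- a ℤ.+ + k /N⌋)) (ℚ.neg-antimono-≤ shifted)
    where
    shifted : ι ⌊ ℤ.- a ℤ.+ + k /N⌋ ≤ 1ℚ
    shifted = subst (ι ⌊ ℤ.- a ℤ.+ + k /N⌋ ≤_) (trans (cong (_+ 1ℚ) (ι⌊k/N⌋≡0 k<N)) (ℚ.+-identityˡ 1ℚ))
      (ι⌊/N⌋-shift {ℤ.- a ℤ.+ + k} {+ k} 1ℤ (≤-fromDifference (p≤q⇒0≤q-p -N≤a)
        (trans (solve 3 (λ a k n → a :- :- n := (k :+ con 1ℚ :* n) :- (:- a :+ k)) refl (ι a) (ι (+ k)) (ι (+ N)))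
               (cong (λ p → (ι (+ k) + 1ℚ * ι (+ N)) - p) (trans (cong (_+ ι (+ k)) (sym (ι-neg a))) (sym (ι-+ (ℤ.- a) (+ k))))))))

  round-edge : ∀ {a a′ k} → ι a + ι a′ ≤ ι (+ N) → ι (round true a k) + ι (round false a′ k) ≤ 1ℚ
  round-edge {a} {a′} {k} a+a′≤N = subst (_≤ 1ℚ) (cong (λ p → ι ⌊ a ℤ.+ + k /N⌋ + p) (sym (ι-neg ⌊ ℤ.- a′ ℤ.+ + k /N⌋)))
    (≤-fromDifference (p≤q⇒0≤q-p shifted) (solve 2 (λ f g → (g :+ con 1ℚ) :- f := con 1ℚ :- (f :+ :- g)) refl
      (ι ⌊ a ℤ.+ + k /N⌋) (ι ⌊ ℤ.- a′ ℤ.+ + k /N⌋)))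
    where
    shifted : ι ⌊ a ℤ.+ + k /N⌋ ≤ ι ⌊ ℤ.- a′ ℤ.+ + k /N⌋ + 1ℚ
    shifted = ι⌊/N⌋-shift {a ℤ.+ + k} {ℤ.- a′ ℤ.+ + k} 1ℤ (≤-fromDifference (p≤q⇒0≤q-p a+a′≤N)
      (trans (solve 4 (λ a b k n → n :- (a :+ b) := ((:- b :+ k) :+ con 1ℚ :* n) :- (a :+ k)) refl (ι a) (ι a′) (ι (+ k)) (ι (+ N)))
             (cong₂ (λ p q → (p + 1ℚ * ι (+ N)) - q) (trans (cong (_+ ι (+ k)) (sym (ι-neg a′))) (sym (ι-+ (ℤ.- a′) (+ k)))) (sym (ι-+ a (+ k))))))

  round-sum : ∀ b a → sumℚ {N} (λ k → ι (round b a (toℕ k))) ≡ ι a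
  round-sum true  a = hermite a
  round-sum false a = begin
    sumℚ {N} (λ k → ι (ℤ.- ⌊ ℤ.- a ℤ.+ + toℕ k /N⌋))   ≡⟨ sumℚ-cong {N} (λ k → ι-neg ⌊ ℤ.- a ℤ.+ + toℕ k /N⌋) ⟩
    sumℚ {N} (λ k → - ι ⌊ ℤ.- a ℤ.+ + toℕ k /N⌋)       ≡⟨ sumℚ-neg {N} (λ k → ι ⌊ ℤ.- a ℤ.+ + toℕ k /N⌋) ⟩
    - sumℚ {N} (λ k → ι ⌊ ℤ.- a ℤ.+ + toℕ k /N⌋)       ≡⟨ cong -_ (hermite (ℤ.- a)) ⟩
    - ι (ℤ.- a)                                          ≡⟨ cong -_ (ι-neg a) ⟩
    - - ι a                                              ≡⟨ neg-involutive (ι a) ⟩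
    ι a                                                  ∎
    where open ≡-Reasoning

-- The polytope Q(G)

module _ {d : ℕ} (G : SimpleGraph d) where

  edge⇒≢ : ∀ {i j} → Edge G i j → i ≢ j
  edge⇒≢ {i} i~j refl with trans (sym i~j) (irrefl G i)
  ... | ()

  QG-cong : ∀ {x y} → x ≐ y → QG G x → QG G y
  QG-cong x≐y (-1≤x , edges≤1) = (λ i → subst (- 1ℚ ≤_) (x≐y i) (-1≤x i)) ,
    λ i j i~j → subst₂ (λ a b → a + b ≤ 1ℚ) (x≐y i) (x≐y j) (edges≤1 i j i~j)

  QG? : ∀ y → Dec (QG G y)
  QG? y = all? (λ i → - 1ℚ ≤? y i) ×-dec all? (λ i → all? (λ j → (adj G i j Bool.≟ true) →-dec (y i + y j ≤? 1ℚ)))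

  QG-bounded : NoIsolatedVertices G → ∀ {x} → QG G x → ∀ i → x i ≤ 1ℚ + 1ℚ
  QG-bounded noIsolated {x} (-1≤x , edges) i with noIsolated i
  ... | j , i~j = ≤-fromDifference (ℚ.+-mono-≤ (p≤q⇒0≤q-p (edges i j i~j)) (p≤q⇒0≤q-p (-1≤x j)))
    (solve 2 (λ a b → (con 1ℚ :- (a :+ b)) :+ (b :- :- con 1ℚ) := (con 1ℚ :+ con 1ℚ) :- a) refl (x i) (x j))

  hull⊆QG : ∀ {n} {v : Fin n → Pt d} {x} → (∀ k → QG G (v k)) → InConvexHull v x → QG G x
  hull⊆QG {v = v} {x} v∈Q x∈hull = -1≤x , edges
    where
    -1≤x : ∀ i → - 1ℚ ≤ x i
    -1≤x i = ≤-fromDifference (p≤q⇒0≤q-p (hull⊆halfspace v x∈hull (neg (unit i)) 1ℚ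
               (λ k → subst (_≤ 1ℚ) (sym (dot-neg-unitˡ i (v k))) (-1≤⇒-≤1 (proj₁ (v∈Q k) i)))))
               (trans (cong (λ p → 1ℚ - p) (dot-neg-unitˡ i x)) (solve 1 (λ a → con 1ℚ :- (:- a) := a :- (:- con 1ℚ)) refl (x i)))
    edges : ∀ i j → Edge G i j → x i + x j ≤ 1ℚ
    edges i j i~j = subst (_≤ 1ℚ) (dot-unit-pairˡ i j x)
      (hull⊆halfspace v x∈hull (unit i ⊕ unit j) 1ℚ (λ k → subst (_≤ 1ℚ) (sym (dot-unit-pairˡ i j (v k))) (proj₂ (v∈Q k) i j i~j)))

  origin-interior : Interior (QG G) origin
  origin-interior = ½ , 0<½ , λ y near →
      (λ i → <⇒≤ (ℚ.<-trans (ℚ.neg-antimono-< ½<1) (proj₁ (within y near i))))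
    , (λ i j _ → <⇒≤ (subst (y i + y j <_) (solve 0 (con ½ :+ con ½ := con 1ℚ) refl)
                                (ℚ.+-mono-< (proj₂ (within y near i)) (proj₂ (within y near j)))))
    where
    within : ∀ (y : Pt d) → (∀ i → ∣ y i - origin i ∣ < ½) → ∀ i → - ½ < y i × y i < ½
    within y near i = ∣p∣<e⇒-e<p<e (subst (λ p → ∣ p ∣ < ½) (ℚ.+-identityʳ (y i)) (near i))

  origin-unique : NoIsolatedVertices G → ∀ x → IsLatticePoint x → Interior (QG G) x → x ≐ origin
  origin-unique noIsolated x lattice x∈int i = ≤-antisym (x≤0 i) (0≤x i)
    where
    steps = interior⇒axis-steps x∈int
    δ = proj₁ steps
    0<δ = proj₁ (proj₂ steps)

    -1<x : ∀ i → - 1ℚ < x i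
    -1<x i = ≤-<-trans (proj₁ (proj₂ (proj₂ (proj₂ steps) i)) i)
      (<-fromDifference 0<δ (trans (solve 2 (λ a δ → δ := a :- (a :+ :- δ :* con 1ℚ)) refl (x i) δ)
                                   (cong (λ u → x i - (x i + - δ * u)) (sym (unit-same i)))))

    0≤x : ∀ i → 0ℚ ≤ x i
    0≤x i with lattice i
    ... | z , x≡z = subst (0ℚ ≤_) (sym x≡z) (-1<ι⇒0≤ι z (subst (- 1ℚ <_) x≡z (-1<x i)))

    x<1 : ∀ i → x i < 1ℚ
    x<1 i with noIsolated i
    ... | j , i~j = <-fromDifference (ℚ.+-mono-<-≤ (ℚ.+-mono-≤-< (p≤q⇒0≤q-p step-up) 0<δ) (0≤x j))
      (trans (cong₂ (λ u v → ((1ℚ - ((x i + δ * u) + (x j + δ * v))) + δ) + x j) (unit-same i) (unit-diff (edge⇒≢ i~j)))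
             (solve 4 (λ a b δ c → ((c :- ((a :+ δ :* con 1ℚ) :+ (b :+ δ :* con 0ℚ))) :+ δ) :+ b := c :- a) refl (x i) (x j) δ 1ℚ))
      where
      step-up : (x i + δ * unit i i) + (x j + δ * unit i j) ≤ 1ℚ
      step-up = proj₂ (proj₁ (proj₂ (proj₂ steps) i)) i j i~j

    x≤0 : ∀ i → x i ≤ 0ℚ
    x≤0 i with lattice i
    ... | z , x≡z = subst (_≤ 0ℚ) (sym x≡z) (ι<1⇒ι≤0 z (subst (_< 1ℚ) x≡z (x<1 i)))

  QG-centred : ∀ {q : Pt d} c → (∀ m → - 1ℚ ≤ q m) → (∀ m → m ≢ c → q m ≤ 0ℚ) → q c ≤ 1ℚ → QG G q
  QG-centred {q} c -1≤q q≤0 q≤1 = -1≤q , edges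
    where
    q≤1′ : ∀ m → q m ≤ 1ℚ
    q≤1′ m with m ≟ c
    ... | yes refl = q≤1
    ... | no  m≢c  = ≤-trans (q≤0 m m≢c) (<⇒≤ 0<1)
    edges : ∀ i j → Edge G i j → q i + q j ≤ 1ℚ
    edges i j i~j with i ≟ c
    ... | yes refl = subst (q i + q j ≤_) (ℚ.+-identityʳ 1ℚ) (ℚ.+-mono-≤ q≤1 (q≤0 j (edge⇒≢ i~j ∘ sym)))
    ... | no  i≢c  = subst (q i + q j ≤_) (ℚ.+-identityˡ 1ℚ) (ℚ.+-mono-≤ (q≤0 i i≢c) (q≤1′ j))

  QG-unit : ∀ c → QG G (unit c)
  QG-unit c = QG-centred c (λ m → ≤-trans (ℚ.neg-antimono-≤ (<⇒≤ 0<1)) (0≤unit c m))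
    (λ m m≢c → ℚ.≤-reflexive (unit-diff (m≢c ∘ sym))) (ℚ.≤-reflexive (unit-same c))

  QG-neg-unit : ∀ c → QG G (neg (unit c))
  QG-neg-unit c = QG-centred c (λ m → ℚ.neg-antimono-≤ (unit≤1 c m))
    (λ m _ → ℚ.neg-antimono-≤ (0≤unit c m)) (≤-trans (ℚ.neg-antimono-≤ (0≤unit c c)) (<⇒≤ 0<1))

  QG-unit-difference : ∀ c k → k ≢ c → QG G (unit c ⊕ neg (unit k))
  QG-unit-difference c k k≢c = QG-centred c
    (λ m → subst (_≤ unit c m - unit k m) (ℚ.+-identityˡ (- 1ℚ)) (ℚ.+-mono-≤ (0≤unit c m) (ℚ.neg-antimono-≤ (unit≤1 k m))))
    (λ m m≢c → subst (_≤ 0ℚ) (sym (trans (cong (_- unit k m) (unit-diff (m≢c ∘ sym))) (ℚ.+-identityˡ _)))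
                     (ℚ.neg-antimono-≤ (0≤unit k m)))
    (ℚ.≤-reflexive (trans (cong₂ _-_ (unit-same c) (unit-diff k≢c)) (ℚ.+-identityʳ 1ℚ)))

  -- The dual polytope

  edge? : ∀ ij → Dec (Edge G (proj₁ ij) (proj₂ ij))
  edge? (i , j) = adj G i j Bool.≟ true

  edges : List (Fin d × Fin d)
  edges = filter edge? (cartesianProduct (allFin d) (allFin d))

  unitPair : Fin d × Fin d → Pt d
  unitPair (i , j) = unit i ⊕ unit j

  dualGenerators : List (Pt d)
  dualGenerators = origin ∷ tabulate (neg ∘ unit) ++ map unitPair edges

  dualGenerator : Fin (length dualGenerators) → Pt d
  dualGenerator = lookup dualGenerators

  ∈-dualGenerators⁻ : ∀ {p} → p ∈ dualGenerators → p ≡ origin ⊎ DualVertexSet G p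
  ∈-dualGenerators⁻ (here p≡0) = inj₁ p≡0
  ∈-dualGenerators⁻ (there p∈) with ∈-++⁻ (tabulate (neg ∘ unit)) p∈
  ... | inj₁ p∈negs with ∈-tabulate⁻ p∈negs
  ...   | i , refl = inj₂ (inj₂ (i , λ _ → refl))
  ∈-dualGenerators⁻ (there p∈) | inj₂ p∈pairs with ∈-map⁻ unitPair p∈pairs
  ...   | (i , j) , ij∈edges , refl = inj₂ (inj₁ (i , j , proj₂ (∈-filter⁻ edge? {xs = cartesianProduct (allFin d) (allFin d)} ij∈edges) , λ _ → refl))

  neg-unit∈dualGenerators : ∀ i → neg (unit i) ∈ dualGenerators
  neg-unit∈dualGenerators i = there (∈-++⁺ˡ (∈-tabulate⁺ i))

  unit-pair∈dualGenerators : ∀ {i j} → Edge G i j → unit i ⊕ unit j ∈ dualGenerators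
  unit-pair∈dualGenerators {i} {j} i~j = there (∈-++⁺ʳ (tabulate (neg ∘ unit))
    (∈-map⁺ unitPair (∈-filter⁺ edge? (∈-cartesianProduct⁺ (∈-allFin i) (∈-allFin j)) i~j)))

  generator∈dual : ∀ {p} → p ≡ origin ⊎ DualVertexSet G p → Dual (QG G) p
  generator∈dual (inj₁ refl) y _ = subst (_≤ 1ℚ) (sym (dot-originˡ y)) (<⇒≤ 0<1)
  generator∈dual (inj₂ (inj₁ (i , j , i~j , p≐))) y (_ , edges≤1) =
    subst (_≤ 1ℚ) (sym (trans (dot-congˡ y p≐) (dot-unit-pairˡ i j y))) (edges≤1 i j i~j)
  generator∈dual (inj₂ (inj₂ (i , p≐))) y (-1≤y , _) =
    subst (_≤ 1ℚ) (sym (trans (dot-congˡ y p≐) (dot-neg-unitˡ i y))) (-1≤⇒-≤1 (-1≤y i))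

  hull⊆dual : ∀ {x} → InConvexHull dualGenerator x → Dual (QG G) x
  hull⊆dual {x} x∈hull y y∈Q = subst (_≤ 1ℚ) (dot-comm y x) (hull⊆halfspace dualGenerator x∈hull y 1ℚ
    λ k → subst (_≤ 1ℚ) (dot-comm (dualGenerator k) y) (generator∈dual (∈-dualGenerators⁻ (∈-lookup k)) y y∈Q))

  dual⊆hull : ∀ {x} → Dual (QG G) x → InConvexHull dualGenerator x
  dual⊆hull {x} x∈dual = hull-by-halfspaces dualGenerator x bounded
    where
    bounded : ∀ c β → (∀ k → dot c (dualGenerator k) ≤ β) → dot c x ≤ β
    bounded c β c·g≤β with dot c x ≤? β
    ... | yes c·x≤β = c·x≤β
    ... | no  c·x≰β = contradiction (<-≤-trans 1<x·sc (x∈dual (s ⊛ c) sc∈Q)) (ℚ.<-irrefl refl)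
      where
      at : ∀ {p} → p ∈ dualGenerators → dot c p ≤ β
      at p∈ with ∈⇒lookup p∈
      ... | k , refl = c·g≤β k
      0≤β : 0ℚ ≤ β
      0≤β = subst (_≤ β) (dot-originʳ c) (at (here refl))
      scaling = separating-scale 0≤β (ℚ.≰⇒> c·x≰β)
      s = proj₁ scaling
      0<s = proj₁ (proj₂ scaling)
      sβ≤1 = proj₁ (proj₂ (proj₂ scaling))
      sc∈Q : QG G (s ⊛ c)
      sc∈Q = -1≤sc , sc+sc≤1
        where
        -1≤sc : ∀ i → - 1ℚ ≤ s * c i
        -1≤sc i = ≤-trans (ℚ.neg-antimono-≤ sβ≤1) (≤-trans
          (ℚ.≤-reflexive (ℚ.neg-distribʳ-* s β))
          (*-monoˡ-≤-0≤ (<⇒≤ 0<s) (subst (- β ≤_) (neg-involutive (c i))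
            (ℚ.neg-antimono-≤ (subst (_≤ β) (trans (dot-comm c (neg (unit i))) (dot-neg-unitˡ i c)) (at (neg-unit∈dualGenerators i)))))))
        sc+sc≤1 : ∀ i j → Edge G i j → s * c i + s * c j ≤ 1ℚ
        sc+sc≤1 i j i~j = ≤-trans (ℚ.≤-reflexive (sym (ℚ.*-distribˡ-+ s (c i) (c j))))
          (≤-trans (*-monoˡ-≤-0≤ (<⇒≤ 0<s)
            (subst (_≤ β) (trans (dot-comm c (unit i ⊕ unit j)) (dot-unit-pairˡ i j c)) (at (unit-pair∈dualGenerators i~j))))
            sβ≤1)
      1<x·sc : 1ℚ < dot x (s ⊛ c)
      1<x·sc = subst (1ℚ <_) (sym (trans (dot-⊛ʳ x s c) (cong (s *_) (dot-comm x c)))) (proj₂ (proj₂ (proj₂ scaling)))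

  origin-not-vertex : NoIsolatedVertices G → Fin d → ∀ {x} → x ≐ origin → ¬ IsVertex (Dual (QG G)) x
  origin-not-vertex noIsolated i {x} x≐0 (_ , extreme) with noIsolated i
  ... | j , i~j = ℚ.1≢0 (trans (sym y-i) (trans (extreme y z ⅓ y∈dual z∈dual (from-yes (0ℚ ℚ.<? ⅓)) (from-yes (⅓ ℚ.<? 1ℚ)) split i) (x≐0 i)))
    where
    ⅓ : ℚ
    ⅓ = + 1 / 3
    y : Pt d
    y = unit i ⊕ unit j
    y∈dual : Dual (QG G) y
    y∈dual = generator∈dual (inj₂ (inj₁ (i , j , i~j , λ _ → refl)))
    z : Pt d
    z = (- ½) ⊛ y
    z∈dual : Dual (QG G) z
    z∈dual q (-1≤q , _) = ≤-fromDifference (0≤* (<⇒≤ 0<½) (ℚ.+-mono-≤ (p≤q⇒0≤q-p (-1≤q i)) (p≤q⇒0≤q-p (-1≤q j))))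
      (trans (solve 2 (λ a b → con ½ :* ((a :- :- con 1ℚ) :+ (b :- :- con 1ℚ)) := con 1ℚ :- con (- ½) :* (a :+ b)) refl (q i) (q j))
             (cong (λ p → 1ℚ - p) (sym (trans (dot-⊛ˡ (- ½) y q) (cong ((- ½) *_) (dot-unit-pairˡ i j q))))))
    split : x ≐ ((⅓ ⊛ y) ⊕ ((1ℚ - ⅓) ⊛ z))
    split m = trans (x≐0 m) (solve 1 (λ a → con 0ℚ := con ⅓ :* a :+ (con 1ℚ :- con ⅓) :* (con (- ½) :* a)) refl (y m))
    y-i : y i ≡ 1ℚ
    y-i = trans (cong₂ _+_ (unit-same i) (unit-diff (edge⇒≢ i~j ∘ sym))) (ℚ.+-identityʳ 1ℚ)

  private
    Splits : Pt d → Set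
    Splits x = ∀ y z t → Dual (QG G) y → Dual (QG G) z → 0ℚ < t → t < 1ℚ → x ≐ ((t ⊛ y) ⊕ ((1ℚ - t) ⊛ z)) → y ≐ x

  unit-pair-vertex : ∀ {i j x} → Edge G i j → x ≐ (unit i ⊕ unit j) → IsVertex (Dual (QG G)) x
  unit-pair-vertex {i} {j} {x} i~j x≐ = generator∈dual (inj₂ (inj₁ (i , j , i~j , x≐))) , extreme
    where
    i≢j = edge⇒≢ i~j
    extreme : Splits x
    extreme y z t y∈ z∈ 0<t t<1 split m = coordinate m
      where
      tight : ∀ {q} → QG G q → q i + q j ≡ 1ℚ → dot y q ≡ 1ℚ
      tight {q} q∈Q q-sum = tight-constituent y∈ z∈ 0<t t<1 split q∈Q (trans (dot-congˡ q x≐) (trans (dot-unit-pairˡ i j q) q-sum))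
      y-i : y i ≡ 1ℚ
      y-i = trans (sym (dot-unitʳ y i)) (tight (QG-unit i)
              (trans (cong₂ _+_ (unit-same i) (unit-diff i≢j)) (ℚ.+-identityʳ 1ℚ)))
      y-j : y j ≡ 1ℚ
      y-j = trans (sym (dot-unitʳ y j)) (tight (QG-unit j)
              (trans (cong₂ _+_ (unit-diff (i≢j ∘ sym)) (unit-same j)) (ℚ.+-identityˡ 1ℚ)))
      coordinate : ∀ m → y m ≡ x m
      coordinate m with m ≟ i | m ≟ j
      ... | yes refl | _ = trans y-i (sym (trans (x≐ i) (trans (cong₂ _+_ (unit-same i) (unit-diff (i≢j ∘ sym))) (ℚ.+-identityʳ 1ℚ))))
      ... | no _ | yes refl = trans y-j (sym (trans (x≐ j) (trans (cong₂ _+_ (unit-diff i≢j) (unit-same j)) (ℚ.+-identityˡ 1ℚ))))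
      ... | no m≢i | no m≢j = trans y-m (sym (trans (x≐ m) (trans (cong₂ _+_ (unit-diff (m≢i ∘ sym)) (unit-diff (m≢j ∘ sym))) (ℚ.+-identityʳ 0ℚ))))
        where
        y-m : y m ≡ 0ℚ
        y-m = trans (solve 2 (λ a b → b := a :- (a :- b)) refl (y i) (y m)) (trans (cong₂ (λ a b → a - b) y-i
          (trans (sym (dot-unit-differenceʳ y i m)) (tight (QG-unit-difference i m m≢i)
            (trans (cong₂ _+_ (cong₂ _-_ (unit-same i) (unit-diff m≢i)) (cong₂ _-_ (unit-diff i≢j) (unit-diff m≢j)))
                   (solve 0 ((con 1ℚ :- con 0ℚ) :+ (con 0ℚ :- con 0ℚ) := con 1ℚ) refl)))))
          (ℚ.+-inverseʳ 1ℚ))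

  neg-unit-vertex : ∀ {i x} → x ≐ neg (unit i) → IsVertex (Dual (QG G)) x
  neg-unit-vertex {i} {x} x≐ = generator∈dual (inj₂ (inj₂ (i , x≐))) , extreme
    where
    extreme : Splits x
    extreme y z t y∈ z∈ 0<t t<1 split m = coordinate m
      where
      tight : ∀ {q} → QG G q → - q i ≡ 1ℚ → dot y q ≡ 1ℚ
      tight {q} q∈Q -q-i = tight-constituent y∈ z∈ 0<t t<1 split q∈Q (trans (dot-congˡ q x≐) (trans (dot-neg-unitˡ i q) -q-i))
      y-i : y i ≡ - 1ℚ
      y-i = trans (sym (neg-involutive (y i))) (cong -_ (trans (sym (dot-neg-unitʳ y i))
              (tight (QG-neg-unit i) (trans (neg-involutive (unit i i)) (unit-same i)))))
      coordinate : ∀ m → y m ≡ x m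
      coordinate m with m ≟ i
      ... | yes refl = trans y-i (sym (trans (x≐ i) (cong -_ (unit-same i))))
      ... | no m≢i = trans y-m (sym (trans (x≐ m) (cong -_ (unit-diff (m≢i ∘ sym)))))
        where
        y-m : y m ≡ 0ℚ
        y-m = trans (solve 2 (λ a b → a := (a :- b) :+ b) refl (y m) (y i)) (trans (cong₂ _+_
          (trans (sym (dot-unit-differenceʳ y m i)) (tight (QG-unit-difference m i (m≢i ∘ sym))
            (trans (cong -_ (cong₂ _-_ (unit-diff m≢i) (unit-same i))) (solve 0 (:- (con 0ℚ :- con 1ℚ) := con 1ℚ) refl))))
          y-i) (ℚ.+-inverseʳ 1ℚ))

  DualVertexSet-cong : ∀ {x x′} → x ≐ x′ → DualVertexSet G x → DualVertexSet G x′
  DualVertexSet-cong x≐x′ (inj₁ (i , j , i~j , x≐)) = inj₁ (i , j , i~j , λ m → trans (sym (x≐x′ m)) (x≐ m))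
  DualVertexSet-cong x≐x′ (inj₂ (i , x≐))           = inj₂ (i , λ m → trans (sym (x≐x′ m)) (x≐ m))

  vertex⇒DualVertexSet : NoIsolatedVertices G → Fin d → ∀ {x} → IsVertex (Dual (QG G)) x → DualVertexSet G x
  vertex⇒DualVertexSet noIsolated i {x} x-vertex = classify (∈-dualGenerators⁻ (∈-lookup k))
    where
    found = vertex∈generators dualGenerator hull⊆dual x-vertex (dual⊆hull (proj₁ x-vertex))
    k = proj₁ found
    gₖ≐x = proj₂ found
    classify : dualGenerator k ≡ origin ⊎ DualVertexSet G (dualGenerator k) → DualVertexSet G x
    classify (inj₁ gₖ≡0) = contradiction x-vertex (origin-not-vertex noIsolated i λ m → trans (sym (gₖ≐x m)) (cong (λ p → p m) gₖ≡0))
    classify (inj₂ gₖ∈)  = DualVertexSet-cong gₖ≐x gₖ∈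

  DualVertexSet⇒vertex : ∀ {x} → DualVertexSet G x → IsVertex (Dual (QG G)) x
  DualVertexSet⇒vertex (inj₁ (i , j , i~j , x≐)) = unit-pair-vertex i~j x≐
  DualVertexSet⇒vertex (inj₂ (i , x≐))           = neg-unit-vertex {i} x≐

  generator-lattice : ∀ {p} → p ≡ origin ⊎ DualVertexSet G p → IsLatticePoint p
  generator-lattice (inj₁ refl) i = 0ℤ , refl
  generator-lattice (inj₂ (inj₁ (i , j , _ , p≐))) = lattice-cong (λ m → sym (p≐ m)) (lattice-⊕ (lattice-unit i) (lattice-unit j))
  generator-lattice (inj₂ (inj₂ (i , p≐)))         = lattice-cong (λ m → sym (p≐ m)) (lattice-neg (lattice-unit i))

  dual-lattice-polytope : IsLatticePolytope (Dual (QG G))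
  dual-lattice-polytope = length dualGenerators , dualGenerator ,
    (λ k → generator-lattice (∈-dualGenerators⁻ (∈-lookup k))) , λ x → dual⊆hull , hull⊆dual

  -- R k rounds (N x_i + k)/N down on one colour class and (N x_i − k)/N up on the other;
  -- since every edge joins the two classes, R k stays in Q(G).
  lattice-average : Bipartite G → ∀ {x} → QG G x →
    ∃[ n ] Σ (Fin (suc n) → Pt d) λ R → (∀ k → IsLatticePoint (R k) × QG G (R k))
                                       × (∀ i → sumℚ (λ k → R k i) ≡ ι (+ suc n) * x i)
  lattice-average (colour , proper) {x} (-1≤x , edges≤1) = n , R , (λ k → (λ i → round (colour i) (A i) (toℕ k) , refl) , R∈Q k) , R-sum
    where
    denominator = commonDenominator x
    n = proj₁ denominator
    N = suc n
    A = proj₁ (proj₂ denominator)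
    A≡ = proj₂ (proj₂ denominator)
    M = ι (+ N)
    open Floor N
    R : Fin N → Pt d
    R k i = ι (round (colour i) (A i) (toℕ k))

    0≤M : 0ℚ ≤ M
    0≤M = ι-mono-≤ {0ℤ} {+ N} (ℤ.+≤+ ℕ.z≤n)

    -M≤A : ∀ i → - M ≤ ι (A i)
    -M≤A i = subst₂ _≤_ (solve 1 (λ m → m :* (:- con 1ℚ) := :- m) refl M) (sym (A≡ i))
               (*-monoˡ-≤-0≤ 0≤M (-1≤x i))

    A+A≤M : ∀ i j → Edge G i j → ι (A i) + ι (A j) ≤ M
    A+A≤M i j i~j = subst₂ _≤_ (trans (ℚ.*-distribˡ-+ M (x i) (x j)) (sym (cong₂ _+_ (A≡ i) (A≡ j)))) (ℚ.*-identityʳ M)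
                      (*-monoˡ-≤-0≤ 0≤M (edges≤1 i j i~j))

    R∈Q : ∀ k → QG G (R k)
    R∈Q k = (λ i → round-lower (colour i) {A i} (-M≤A i) (toℕ<n k)) , edge
      where
      edge : ∀ i j → Edge G i j → R k i + R k j ≤ 1ℚ
      edge i j i~j with colour i | colour j | proper i j i~j
      ... | true  | true  | c≢c = contradiction refl c≢c
      ... | false | false | c≢c = contradiction refl c≢c
      ... | true  | false | _   = round-edge {A i} {A j} {toℕ k} (A+A≤M i j i~j)
      ... | false | true  | _   = subst (_≤ 1ℚ) (ℚ.+-comm (ι (round true (A j) (toℕ k))) (ι (round false (A i) (toℕ k))))
        (round-edge {A j} {A i} {toℕ k} (subst (_≤ M) (ℚ.+-comm (ι (A i)) (ι (A j))) (A+A≤M i j i~j)))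

    R-sum : ∀ i → sumℚ (λ k → R k i) ≡ M * x i
    R-sum i = trans (round-sum (colour i) (A i)) (A≡ i)

  latticePoints : List (Pt d)
  latticePoints = filter QG? (box d)

  latticePoint : Fin (length latticePoints) → Pt d
  latticePoint = lookup latticePoints

  latticePoint-lattice : ∀ m → IsLatticePoint (latticePoint m)
  latticePoint-lattice m = box-lattice (proj₁ (∈-filter⁻ QG? {xs = box d} (∈-lookup m)))

  latticePoint∈QG : ∀ m → QG G (latticePoint m)
  latticePoint∈QG m = proj₂ (∈-filter⁻ QG? {xs = box d} (∈-lookup m))

  lattice∩QG⊆latticePoints : NoIsolatedVertices G → ∀ {y} → IsLatticePoint y → QG G y → ∃[ m ] latticePoint m ≐ y
  lattice∩QG⊆latticePoints noIsolated {y} y-lattice y∈Q = m , λ i → trans (cong (λ p → p i) gₘ≡q) (q≐y i)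
    where
    y∈smallIntegers : ∀ i → y i ∈ smallIntegers
    y∈smallIntegers i with y-lattice i
    ... | z , y≡z = subst (_∈ smallIntegers) (sym y≡z)
      (integer∈smallIntegers z (subst (- 1ℚ ≤_) y≡z (proj₁ y∈Q i)) (subst (_≤ 1ℚ + 1ℚ) y≡z (QG-bounded noIsolated y∈Q i)))
    inBox = ∈-box y y∈smallIntegers
    q≐y = proj₂ (proj₂ inBox)
    found = ∈⇒lookup (∈-filter⁺ QG? (proj₁ (proj₂ inBox)) (QG-cong (λ i → sym (q≐y i)) y∈Q))
    m = proj₁ found
    gₘ≡q = proj₂ found

  QG⊆hull-latticePoints : NoIsolatedVertices G → Bipartite G → ∀ {x} → QG G x → InConvexHull latticePoint x
  QG⊆hull-latticePoints noIsolated bipartite {x} x∈Q = hull-by-halfspaces latticePoint x bounded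
    where
    average = lattice-average bipartite x∈Q
    N = suc (proj₁ average)
    R = proj₁ (proj₂ average)
    M = ι (+ N)
    R-lattice∈Q = proj₁ (proj₂ (proj₂ average))
    R-sum = proj₂ (proj₂ (proj₂ average))
    bounded : ∀ c β → (∀ m → dot c (latticePoint m) ≤ β) → dot c x ≤ β
    bounded c β c·W≤β = *-cancelˡ-≤-0< (ι-mono-< {0ℤ} {+ N} (ℤ.+<+ (ℕ.s≤s ℕ.z≤n))) (begin
      M * dot c x                ≡⟨ sym (dot-⊛ʳ c M x) ⟩
      dot c (M ⊛ x)              ≡⟨ sym (dot-congʳ c R-sum) ⟩
      dot c (sumPt R)            ≡⟨ dot-sumPt c R ⟩
      sumℚ (λ k → dot c (R k))   ≤⟨ sumℚ-mono-≤ c·R≤β ⟩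
      sumℚ {N} (λ _ → β)         ≡⟨ sumℚ-const N β ⟩
      M * β                      ∎)
      where
      open ℚ.≤-Reasoning
      c·R≤β : ∀ k → dot c (R k) ≤ β
      c·R≤β k = subst (_≤ β) (dot-congʳ c (proj₂ found)) (c·W≤β (proj₁ found))
        where found = lattice∩QG⊆latticePoints noIsolated (proj₁ (R-lattice∈Q k)) (proj₂ (R-lattice∈Q k))

  QG-lattice-polytope : NoIsolatedVertices G → Bipartite G → IsLatticePolytope (QG G)
  QG-lattice-polytope noIsolated bipartite = length latticePoints , latticePoint , latticePoint-lattice ,
    λ x → QG⊆hull-latticePoints noIsolated bipartite , hull⊆QG latticePoint∈QG

proposition2p4 : ∀ (d : ℕ) → 1 ℕ.≤ d → (G : SimpleGraph d) → NoIsolatedVertices G →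
    OriginUniqueInteriorLatticePoint (QG G)
    × (∀ x → IsVertex (Dual (QG G)) x ⇔ DualVertexSet G x)
    × (Bipartite G → IsGorensteinFano (QG G))
proposition2p4 d 1≤d G noIsolated =
    originUnique
  , (λ x → mk⇔ (vertex⇒DualVertexSet G noIsolated (fromℕ< 1≤d)) (DualVertexSet⇒vertex G))
  , λ bipartite → (QG-lattice-polytope G noIsolated bipartite , (origin , origin-interior G) , originUnique)
                , dual-lattice-polytope G
  where
  originUnique : OriginUniqueInteriorLatticePoint (QG G)
  originUnique = origin-interior G , origin-unique G noIsolated
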